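{- Let $\alpha_1\ge\alpha_2\ge\alpha_3\ge0$ be integers and $\alpha=(\alpha_1,\alpha_2,\alpha_3,0)$. For every $n\ge4$, $$\Delta^{(2,2)}(\Delta^{(2,1,1)})^2\Delta^{(1^4)}\big(s_{(n+\alpha_1)}s_{(n+\alpha_2)}s_{(n+\alpha_3)}s_{(n)}\big)=\sum_{A}s_{(|a_1|,|a_2|,|a_3|)},$$ where the sum runs over all $A\in P^{\mathbb{Z}}_{4,n,\alpha}$ satisfying all of: $a_{41}=0$; ($a_{14}=0$ or $a_{31}=0$); ($a_{13}=0$ or $a_{32}=0$ or $a_{31}=a_{21}$ or $a_{21}+a_{22}+a_{23}=a_{11}+a_{12}+a_{13}$); and ($a_{12}=0$ or $a_{22}=0$ or $a_{23}=0$ or $a_{21}+a_{22}=a_{11}+a_{12}$ or $a_{31}+a_{32}=a_{21}+a_{22}$).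
   Context: The product is viewed as the sequence $\{s_{(n+\alpha_1)}s_{(n+\alpha_2)}s_{(n+\alpha_3)}s_{(n)}\}_n$, with $f_n$ homogeneous of degree $4n+\alpha_1+\alpha_2+\alpha_3$. For partitions $\lambda=(\lambda_1,\dots,\lambda_l)$, $\mu=(\mu_1,\dots,\mu_r)$ with $l\le r$, $\lambda+\mu=\mu+\lambda=(\lambda_1+\mu_1,\dots,\lambda_l+\mu_l,\mu_{l+1},\dots,\mu_r)$; for $f=\sum c_\nu s_\nu$, $f+\lambda:=\sum c_\nu s_{\nu+\lambda}$. For a partition $\lambda$ with $|\lambda|=4$, $\Delta^\lambda$ acts termwise by $\Delta^\lambda f_n=f_n-(f_{n-1}+\lambda)$; products/powers are compositions; $(1^4)=(1,1,1,1)$. A partial matrix $A=(a_{ij})$ has entries indexed by $1\le i\le4$, $1\le j\le 5-i$, rows $a_i$, $|a_i|=\sum_j a_{ij}$. $P_{4,n,\alpha}$ is the set of real partial matrices with $0\le a_{ij}\le n+\alpha_{i+j-1}$; $\sum_{j=1}^{m}a_{ij}\le\sum_{j=1}^{m}a_{(i-1)j}$ for $2\le i\le4$, $1\le m\le5-i$; and $\sum_{i=1}^{m}a_{i,m+1-i}=n+\alpha_m$ for $1\le m\le4$ (with $\alpha_4=0$). $P^{\mathbb{Z}}_{4,n,\alpha}$ is its set of integer points. -}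

module Defs where

open import Data.Bool using (Bool; true; false; _∧_; _∨_; if_then_else_; not)
open import Data.Nat using (ℕ; zero; suc; _+_; _∸_; _≤_; _<_; _≥_; _≤ᵇ_; _≡ᵇ_)
open import Data.Integer using (ℤ; +_; _-_)
open import Data.Product using (_×_)
open import Data.List using (List; []; _∷_; map; concatMap; upTo; filterᵇ; length; foldr)
open import Data.Nat.ListAction using (sum)
open import Data.List.Relation.Unary.All using (All)
open import Data.List.Relation.Unary.Linked using (Linked)
open import Data.Maybe using (Maybe; just; nothing)

IsPartition : List ℕ → Set
IsPartition ν = Linked _≥_ ν × All (0 <_) ν

size : List ℕ → ℕ
size = sum

stripZeros : List ℕ → List ℕ
stripZeros = filterᵇ (λ x → not (x ≡ᵇ 0))

nonincᵇ : List ℕ → Bool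
nonincᵇ [] = true
nonincᵇ (x ∷ []) = true
nonincᵇ (x ∷ y ∷ r) = (y ≤ᵇ x) ∧ nonincᵇ (y ∷ r)

allZeroᵇ : List ℕ → Bool
allZeroᵇ = foldr (λ x b → (x ≡ᵇ 0) ∧ b) true

listEqᵇ : List ℕ → List ℕ → Bool
listEqᵇ [] [] = true
listEqᵇ (x ∷ xs) (y ∷ ys) = (x ≡ᵇ y) ∧ listEqᵇ xs ys
listEqᵇ _ _ = false

range : ℕ → ℕ → List ℕ
range lo hi = map (λ k → lo + k) (upTo (suc (hi ∸ lo)))

-- Symmetric functions, written in the Schur basis: an element
-- f = Σ c_ν s_ν is given by its coefficient function ν ↦ c_ν
-- (only evaluated at genuine partitions ν).

SymFun : Set
SymFun = List ℕ → ℤ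

-- all μ (possibly with trailing zeros, length ≤ length ν) such that
-- ν/μ is a horizontal strip, i.e. ν₁ ≥ μ₁ ≥ ν₂ ≥ μ₂ ≥ … ≥ ν_k ≥ μ_k ≥ 0
strips : List ℕ → List (List ℕ)
strips [] = [] ∷ []
strips (x ∷ []) = map (λ m → m ∷ []) (range 0 x)
strips (x ∷ y ∷ r) = concatMap (λ m → map (m ∷_) (strips (y ∷ r))) (range y x)

-- coefficient of s_ν in the product h_{c₁} h_{c₂} ⋯ h_{c_k}
-- (= s_{(c₁)} ⋯ s_{(c_k)}), computed by iterating the Pieri rule
-- h_a s_μ = Σ_{ν/μ horizontal strip of size a} s_ν.
pieriCoeff : List ℕ → List ℕ → ℕ
pieriCoeff [] ν = if allZeroᵇ ν then 1 else 0
pieriCoeff (a ∷ as) ν =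
  sum (map (pieriCoeff as)
           (filterᵇ (λ μ → size ν ≡ᵇ (size μ + a)) (strips ν)))

rowProduct : List ℕ → SymFun
rowProduct cs ν = + pieriCoeff cs ν

subPart : List ℕ → List ℕ → Maybe (List ℕ)
subPart μ [] = just μ
subPart [] (l ∷ ls) = if l ≡ᵇ 0 then Data.Maybe.map (0 ∷_) (subPart [] ls) else nothing
subPart (m ∷ ms) (l ∷ ls) =
  if l ≤ᵇ m then Data.Maybe.map ((m ∸ l) ∷_) (subPart ms ls) else nothing

-- f + λ := Σ c_ν s_{ν+λ}.  Coefficient of s_μ in f + λ is c_ν where
-- ν is the (unique) partition with ν + λ = μ, or 0 if there is none.
_⊕_ : SymFun → List ℕ → SymFun
(f ⊕ λ') μ with subPart μ λ'
... | nothing = + 0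
... | just ν = if nonincᵇ ν then f (stripZeros ν) else + 0

infixl 6 _⊕_

_-ˢ_ : SymFun → SymFun → SymFun
(f -ˢ g) ν = f ν - g ν

Seq : Set
Seq = ℕ → SymFun

Δ : List ℕ → Seq → Seq
Δ λ' f n = f n -ˢ (f (n ∸ 1) ⊕ λ')

record PMat : Set where
  constructor pmat
  field
    a11 a12 a13 a14 : ℕ
    a21 a22 a23 : ℕ
    a31 a32 : ℕ
    a41 : ℕ
open PMat public

alpha : ℕ → ℕ → ℕ → ℕ → ℕ
alpha α₁ α₂ α₃ 1 = α₁
alpha α₁ α₂ α₃ 2 = α₂
alpha α₁ α₂ α₃ 3 = α₃
alpha α₁ α₂ α₃ _ = 0

-- All integer matrices with 0 ≤ a_ij ≤ n + α_{i+j-1}.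
boxMats : ℕ → ℕ → ℕ → ℕ → List PMat
boxMats α₁ α₂ α₃ n =
  concatMap (λ x11 → concatMap (λ x12 → concatMap (λ x13 → concatMap (λ x14 →
  concatMap (λ x21 → concatMap (λ x22 → concatMap (λ x23 →
  concatMap (λ x31 → concatMap (λ x32 →
  map (λ x41 → pmat x11 x12 x13 x14 x21 x22 x23 x31 x32 x41)
    (range 0 (b 4)))
    (range 0 (b 4))) (range 0 (b 3)))
    (range 0 (b 4))) (range 0 (b 3))) (range 0 (b 2)))
    (range 0 (b 4))) (range 0 (b 3))) (range 0 (b 2))) (range 0 (b 1))
  where
    b : ℕ → ℕ
    b m = n + alpha α₁ α₂ α₃ m

inPᵇ : ℕ → ℕ → ℕ → ℕ → PMat → Bool
inPᵇ α₁ α₂ α₃ n (pmat x11 x12 x13 x14 x21 x22 x23 x31 x32 x41) =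
  (x21 ≤ᵇ x11) ∧ ((x21 + x22) ≤ᵇ (x11 + x12)) ∧
  ((x21 + x22 + x23) ≤ᵇ (x11 + x12 + x13)) ∧
  (x31 ≤ᵇ x21) ∧ ((x31 + x32) ≤ᵇ (x21 + x22)) ∧
  (x41 ≤ᵇ x31) ∧
  (x11 ≡ᵇ (n + α₁)) ∧ ((x12 + x21) ≡ᵇ (n + α₂)) ∧
  ((x13 + x22 + x31) ≡ᵇ (n + α₃)) ∧ ((x14 + x23 + x32 + x41) ≡ᵇ n)

-- P^ℤ_{4,n,α}, listed (each element exactly once)
PZ : ℕ → ℕ → ℕ → ℕ → List PMat
PZ α₁ α₂ α₃ n = filterᵇ (inPᵇ α₁ α₂ α₃ n) (boxMats α₁ α₂ α₃ n)

condᵇ : PMat → Bool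
condᵇ (pmat x11 x12 x13 x14 x21 x22 x23 x31 x32 x41) =
  (x41 ≡ᵇ 0) ∧
  ((x14 ≡ᵇ 0) ∨ (x31 ≡ᵇ 0)) ∧
  ((x13 ≡ᵇ 0) ∨ (x32 ≡ᵇ 0) ∨ (x31 ≡ᵇ x21) ∨
     ((x21 + x22 + x23) ≡ᵇ (x11 + x12 + x13))) ∧
  ((x12 ≡ᵇ 0) ∨ (x22 ≡ᵇ 0) ∨ (x23 ≡ᵇ 0) ∨
     ((x21 + x22) ≡ᵇ (x11 + x12)) ∨ ((x31 + x32) ≡ᵇ (x21 + x22)))

rowShape : PMat → List ℕ
rowShape (pmat x11 x12 x13 x14 x21 x22 x23 x31 x32 x41) =
  stripZeros ((x11 + x12 + x13 + x14) ∷ (x21 + x22 + x23) ∷ (x31 + x32) ∷ [])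

rhs : ℕ → ℕ → ℕ → ℕ → SymFun
rhs α₁ α₂ α₃ n ν =
  + length (filterᵇ (λ A → condᵇ A ∧ listEqᵇ (rowShape A) ν) (PZ α₁ α₂ α₃ n))

fSeq : ℕ → ℕ → ℕ → Seq
fSeq α₁ α₂ α₃ n = rowProduct ((n + α₁) ∷ (n + α₂) ∷ (n + α₃) ∷ n ∷ [])

lhsSeq : ℕ → ℕ → ℕ → Seq
lhsSeq α₁ α₂ α₃ =
  Δ (2 ∷ 2 ∷ []) (Δ (2 ∷ 1 ∷ 1 ∷ []) (Δ (2 ∷ 1 ∷ 1 ∷ [])
    (Δ (1 ∷ 1 ∷ 1 ∷ 1 ∷ []) (fSeq α₁ α₂ α₃))))

{-# OPTIONS --safe #-}

-- The coefficient of s_ν in s_(c₁) ⋯ s_(c₄) counts chains ν ⊇ μ₁ ⊇ μ₂ ⊇ μ₃ of horizontal strips of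
-- sizes c₁, …, c₄.  A Bender–Knuth involution shows that this number is symmetric in the cᵢ, and for
-- the content (n + α₁, n + α₂, n + α₃, n) such chains are the Gelfand–Tsetlin patterns of semistandard
-- tableaux, i.e. the integer points of P_{4,n,α} whose row sums form ν.  So f_n counts the matrices of
-- P^ℤ_{4,n,α} by shape.  Adding a fixed 0/1 matrix Eₖ of shape λₖ maps P^ℤ_{4,n-1,α} into P^ℤ_{4,n,α}
-- and adds λₖ to the shape, so Δ^{λₖ} cancels exactly the matrices of the form Eₖ + B.  For the four
-- matrices Eₖ used here (supported on the first column; on a₁₁ a₁₄ a₂₁ a₃₁; on a₁₁ a₁₃ a₂₁ a₃₂; on
-- a₁₁ a₁₂ a₂₂ a₂₃) the matrices not of this form are those satisfying the k-th condition of the theorem.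

module Submission where

open import Defs

open import Data.Bool using (Bool; true; false; _∧_; not; T; T?; if_then_else_)
open import Data.Empty using (⊥; ⊥-elim)
import Data.Integer as ℤ
open import Data.Integer.Properties using (m-n≡m⊖n; ⊖-≥)
open import Data.List using (List; []; _∷_; _++_; map; concatMap; filter; filterᵇ; length; replicate)
open import Data.List.Membership.Propositional using (_∈_; find)
open import Data.List.Membership.Propositional.Properties using (∈-map⁺; ∈-map⁻; ∈-upTo⁺; ∈-upTo⁻; ∈-concatMap⁻)
open import Data.List.Properties
  using (map-++; map-∘; map-cong; map-cong-local; ≡-dec; ∷-injective; ++-assoc; ++-identityʳ; filter-++; filter-all;
         length-++; length-replicate; length-filter)
open import Data.List.Relation.Binary.Pointwise using (Pointwise; []; _∷_)
open import Data.List.Relation.Unary.All as All using (All; []; _∷_)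
import Data.List.Relation.Unary.All.Properties as All
open import Data.List.Relation.Unary.AllPairs using ([]; _∷_)
open import Data.List.Relation.Unary.Any using (here; there)
open import Data.List.Relation.Unary.Linked as Linked using (Linked; []; [-]; _∷_)
import Data.List.Relation.Unary.Linked.Properties as Linked
open import Data.List.Relation.Unary.Unique.Propositional using (Unique)
import Data.List.Relation.Unary.Unique.Propositional.Properties as Unique
open import Data.Maybe using (just; nothing)
open import Data.Nat using (ℕ; zero; suc; _+_; _*_; _∸_; _≤_; _<_; _≥_; z≤n; s≤s; _≡ᵇ_; _≤ᵇ_; _⊔_; _⊓_)
open import Data.Nat.ListAction using (sum)
open import Data.Nat.ListAction.Properties using (sum-++)
open import Data.Nat.Properties
open import Algebra.Properties.CommutativeSemigroup +-commutativeSemigroup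
  using () renaming (interchange to +-interchange)
open import Data.Nat.Solver using (module +-*-Solver)
open +-*-Solver using (solve; _:+_; _:*_; _:=_; con)
open import Data.Product using (_×_; _,_; proj₁; proj₂; ∃)
import Data.Product
open import Data.Product.Properties using (,-injective) renaming (≡-dec to ×-≡-dec)
open import Data.Sum using (_⊎_; inj₁; inj₂; [_,_])
import Data.Sum
open import Data.Unit using (⊤; tt)
open import Function using (_∘_; case_of_)
open import Function.Bundles using (_⇔_; mk⇔; Equivalence)
open import Level using (0ℓ)
open import Relation.Binary.Definitions using (DecidableEquality)
open import Relation.Binary.PropositionalEquality hiding ([_])
open import Relation.Nullary using (¬_; Dec; yes; no; does; map′; _×-dec_; _⊎-dec_; ¬?)
open import Relation.Nullary.Decidable using (from-yes)
open import Relation.Unary using (Pred; Decidable; U; _∩_)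
open import Relation.Unary.Properties using (U?; _∩?_)

private
  variable
    X Y : Set

∑ : List X → (X → ℕ) → ℕ
∑ xs w = sum (map w xs)

⟦_⟧ : Bool → ℕ
⟦ true ⟧ = 1
⟦ false ⟧ = 0

∑-++ : (xs ys : List X) (w : X → ℕ) → ∑ (xs ++ ys) w ≡ ∑ xs w + ∑ ys w
∑-++ xs ys w = trans (cong sum (map-++ w xs ys)) (sum-++ (map w xs) (map w ys))

∑-map : (h : X → Y) (xs : List X) (w : Y → ℕ) → ∑ (map h xs) w ≡ ∑ xs (w ∘ h)
∑-map h xs w = cong sum (sym (map-∘ xs))

∑-concatMap : (f : X → List Y) (xs : List X) (w : Y → ℕ) →
  ∑ (concatMap f xs) w ≡ ∑ xs (λ x → ∑ (f x) w)
∑-concatMap f [] w = refl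
∑-concatMap f (x ∷ xs) w =
  trans (∑-++ (f x) (concatMap f xs) w) (cong (∑ (f x) w +_) (∑-concatMap f xs w))

∑-cong : (xs : List X) {v w : X → ℕ} → (∀ {x} → x ∈ xs → v x ≡ w x) → ∑ xs v ≡ ∑ xs w
∑-cong xs v≡w = cong sum (map-cong-local (All.tabulate v≡w))

∑-cong′ : (xs : List X) {v w : X → ℕ} → (∀ x → v x ≡ w x) → ∑ xs v ≡ ∑ xs w
∑-cong′ xs v≡w = cong sum (map-cong v≡w xs)

∑-zero : (xs : List X) {w : X → ℕ} → (∀ {x} → x ∈ xs → w x ≡ 0) → ∑ xs w ≡ 0
∑-zero [] w≡0 = refl
∑-zero (x ∷ xs) w≡0 = cong₂ _+_ (w≡0 (here refl)) (∑-zero xs (w≡0 ∘ there))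

∑-+ : (xs : List X) (v w : X → ℕ) → ∑ xs (λ x → v x + w x) ≡ ∑ xs v + ∑ xs w
∑-+ [] v w = refl
∑-+ (x ∷ xs) v w =
  trans (cong (v x + w x +_) (∑-+ xs v w)) (+-interchange (v x) (w x) (∑ xs v) (∑ xs w))

∑-*ˡ : (xs : List X) (c : ℕ) (w : X → ℕ) → ∑ xs (λ x → c * w x) ≡ c * ∑ xs w
∑-*ˡ [] c w = sym (*-zeroʳ c)
∑-*ˡ (x ∷ xs) c w = trans (cong (c * w x +_) (∑-*ˡ xs c w)) (sym (*-distribˡ-+ c (w x) (∑ xs w)))

∑-*ʳ : (xs : List X) (c : ℕ) (w : X → ℕ) → ∑ xs (λ x → w x * c) ≡ ∑ xs w * c
∑-*ʳ xs c w = trans (∑-cong′ xs (λ x → *-comm (w x) c)) (trans (∑-*ˡ xs c w) (*-comm c (∑ xs w)))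

∑-comm : (xs : List X) (ys : List Y) (w : X → Y → ℕ) →
  ∑ xs (λ x → ∑ ys (w x)) ≡ ∑ ys (λ y → ∑ xs (λ x → w x y))
∑-comm [] ys w = sym (∑-zero ys (λ _ → refl))
∑-comm (x ∷ xs) ys w =
  trans (cong (∑ ys (w x) +_) (∑-comm xs ys w)) (sym (∑-+ ys (w x) (λ y → ∑ xs (λ x → w x y))))

length-filterᵇ : (p : X → Bool) (xs : List X) → length (filterᵇ p xs) ≡ ∑ xs (λ x → ⟦ p x ⟧)
length-filterᵇ p [] = refl
length-filterᵇ p (x ∷ xs) with p x
... | true = cong suc (length-filterᵇ p xs)
... | false = length-filterᵇ p xs

∑-filterᵇ : (p : X → Bool) (xs : List X) (w : X → ℕ) →
  ∑ (filterᵇ p xs) w ≡ ∑ xs (λ x → ⟦ p x ⟧ * w x)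
∑-filterᵇ p [] w = refl
∑-filterᵇ p (x ∷ xs) w with p x
... | true = cong₂ _+_ (sym (+-identityʳ (w x))) (∑-filterᵇ p xs w)
... | false = ∑-filterᵇ p xs w

⟦does⟧-yes : {P : Set} (P? : Dec P) → P → ⟦ does P? ⟧ ≡ 1
⟦does⟧-yes (yes _) _ = refl
⟦does⟧-yes (no ¬p) p = ⊥-elim (¬p p)

⟦does⟧-no : {P : Set} (P? : Dec P) → ¬ P → ⟦ does P? ⟧ ≡ 0
⟦does⟧-no (yes p) ¬p = ⊥-elim (¬p p)
⟦does⟧-no (no _) _ = refl

⟦does⟧≢0 : {P : Set} (P? : Dec P) → ⟦ does P? ⟧ ≢ 0 → P
⟦does⟧≢0 (yes p) _ = p
⟦does⟧≢0 (no _) ≢0 = ⊥-elim (≢0 refl)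

⟦does⟧*-≢0 : {P : Set} (P? : Dec P) (n : ℕ) → ⟦ does P? ⟧ * n ≢ 0 → P × n ≢ 0
⟦does⟧*-≢0 (yes p) n ≢0 = p , ≢0 ∘ trans (+-identityʳ n)
⟦does⟧*-≢0 (no _) n ≢0 = ⊥-elim (≢0 refl)

⟦does⟧-cong : {P Q : Set} (P? : Dec P) (Q? : Dec Q) → (P → Q) → (Q → P) → ⟦ does P? ⟧ ≡ ⟦ does Q? ⟧
⟦does⟧-cong (yes _) (yes _) _ _ = refl
⟦does⟧-cong (yes p) (no ¬q) P⇒Q _ = ⊥-elim (¬q (P⇒Q p))
⟦does⟧-cong (no ¬p) (yes q) _ Q⇒P = ⊥-elim (¬p (Q⇒P q))
⟦does⟧-cong (no _) (no _) _ _ = refl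

⟦does⟧-*-cong : {P : Set} (P? : Dec P) (c : ℕ) {x y : ℕ} → (P → x ≡ y) → ⟦ does P? ⟧ * c * x ≡ ⟦ does P? ⟧ * c * y
⟦does⟧-*-cong (yes p) c x≡y = cong (1 * c *_) (x≡y p)
⟦does⟧-*-cong (no _) c _ = refl

⟦does⟧²-≢0 : {P Q : Set} (P? : Dec P) (Q? : Dec Q) (x : ℕ) → ⟦ does P? ⟧ * ⟦ does Q? ⟧ * x ≢ 0 → P × Q
⟦does⟧²-≢0 (yes p) (yes q) _ _ = p , q
⟦does⟧²-≢0 (yes _) (no _) _ ≢0 = ⊥-elim (≢0 refl)
⟦does⟧²-≢0 (no _) _ _ ≢0 = ⊥-elim (≢0 refl)

⟦does⟧²-yes : {P Q : Set} (P? : Dec P) (Q? : Dec Q) (x : ℕ) → P → Q → ⟦ does P? ⟧ * ⟦ does Q? ⟧ * x ≡ x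
⟦does⟧²-yes P? Q? x p q rewrite ⟦does⟧-yes P? p | ⟦does⟧-yes Q? q = +-identityʳ x

module _ {X : Set} (_≟_ : DecidableEquality X) where

  multiplicity : X → List X → ℕ
  multiplicity t xs = ∑ xs (λ y → ⟦ does (y ≟ t) ⟧)

  multiplicity-∉ : {t : X} (xs : List X) → (∀ {y} → y ∈ xs → y ≢ t) → multiplicity t xs ≡ 0
  multiplicity-∉ xs ∉ = ∑-zero xs (λ y∈ → ⟦does⟧-no (_ ≟ _) (∉ y∈))

  multiplicity-unique : {t : X} {xs : List X} → Unique xs → t ∈ xs → multiplicity t xs ≡ 1
  multiplicity-unique {t} {x ∷ xs} (x∉xs ∷ _) (here refl) =
    cong₂ _+_ (⟦does⟧-yes (t ≟ t) refl) (multiplicity-∉ xs (λ t∈xs t≡y → All.lookup x∉xs t∈xs (sym t≡y)))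
  multiplicity-unique {t} {x ∷ xs} (x∉xs ∷ unique) (there t∈xs) =
    cong₂ _+_ (⟦does⟧-no (x ≟ t) (All.lookup x∉xs t∈xs)) (multiplicity-unique unique t∈xs)

  ∑-⟦≟⟧-* : (xs : List X) (t : X) (w : X → ℕ) →
    ∑ xs (λ y → ⟦ does (y ≟ t) ⟧ * w y) ≡ multiplicity t xs * w t
  ∑-⟦≟⟧-* xs t w = trans (∑-cong′ xs pointwise) (∑-*ʳ xs (w t) (λ y → ⟦ does (y ≟ t) ⟧))
    where
    pointwise : ∀ y → ⟦ does (y ≟ t) ⟧ * w y ≡ ⟦ does (y ≟ t) ⟧ * w t
    pointwise y with y ≟ t
    ... | yes refl = refl
    ... | no _ = refl

multiplicity-concatMap : {X Y : Set} (_≟X_ : DecidableEquality X) (_≟Y_ : DecidableEquality Y)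
  (f : X → List Y) (π : Y → X) → (∀ x {y} → y ∈ f x → π y ≡ x) →
  (t : Y) (xs : List X) →
  multiplicity _≟Y_ t (concatMap f xs) ≡ multiplicity _≟X_ (π t) xs * multiplicity _≟Y_ t (f (π t))
multiplicity-concatMap _≟X_ _≟Y_ f π π-f t xs =
  trans (∑-concatMap f xs (λ y → ⟦ does (y ≟Y t) ⟧))
    (trans (∑-cong′ xs only-block-π-t) (∑-⟦≟⟧-* _≟X_ xs (π t) (λ x → multiplicity _≟Y_ t (f x))))
  where
  only-block-π-t : ∀ x → multiplicity _≟Y_ t (f x) ≡ ⟦ does (x ≟X π t) ⟧ * multiplicity _≟Y_ t (f x)
  only-block-π-t x with x ≟X π t
  ... | yes refl = sym (+-identityʳ _)
  ... | no x≢πt = multiplicity-∉ _≟Y_ (f x) (λ y∈fx y≡t → x≢πt (trans (sym (π-f x y∈fx)) (cong π y≡t)))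

⟦does⟧-*-transfer : {P Q : Set} (P? : Dec P) (Q? : Dec Q) {a b : ℕ} →
  (a ≢ 0 → P → Q × b ≡ a) → (b ≢ 0 → Q → P × a ≡ b) →
  ⟦ does P? ⟧ * a ≡ ⟦ does Q? ⟧ * b
⟦does⟧-*-transfer (yes p) (yes q) {zero} {zero} _ _ = refl
⟦does⟧-*-transfer (yes p) (yes q) {zero} {suc b} _ Q⇒P = cong (_+ 0) (proj₂ (Q⇒P (λ ()) q))
⟦does⟧-*-transfer (yes p) (yes q) {suc a} P⇒Q _ = cong (_+ 0) (sym (proj₂ (P⇒Q (λ ()) p)))
⟦does⟧-*-transfer (yes p) (no ¬q) {zero} _ _ = refl
⟦does⟧-*-transfer (yes p) (no ¬q) {suc a} P⇒Q _ = ⊥-elim (¬q (proj₁ (P⇒Q (λ ()) p)))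
⟦does⟧-*-transfer (no ¬p) (yes q) {b = zero} _ _ = refl
⟦does⟧-*-transfer (no ¬p) (yes q) {b = suc b} _ Q⇒P = ⊥-elim (¬p (proj₁ (Q⇒P (λ ()) q)))
⟦does⟧-*-transfer (no ¬p) (no ¬q) _ _ = refl

Transported : DecidableEquality Y → (Y → X) → (X → Y) → List Y → (Y → ℕ) → X → ℕ → Set
Transported _≟_ g f ys w x wx = multiplicity _≟_ (f x) ys ≡ 1 × g (f x) ≡ x × w (f x) ≡ wx

module _ {X Y : Set} (_≟X_ : DecidableEquality X) (_≟Y_ : DecidableEquality Y) where

  ∑-bijection : (xs : List X) (ys : List Y) (v : X → ℕ) (w : Y → ℕ) (f : X → Y) (g : Y → X) →
    (∀ {x} → x ∈ xs → v x ≢ 0 → Transported _≟Y_ g f ys w x (v x)) →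
    (∀ {y} → y ∈ ys → w y ≢ 0 → Transported _≟X_ f g xs v y (w y)) →
    ∑ xs v ≡ ∑ ys w
  ∑-bijection xs ys v w f g forth back = begin
    ∑ xs v                                                   ≡⟨ ∑-cong xs (λ x∈xs → counted (proj₁ ∘ forth x∈xs)) ⟩
    ∑ xs (λ x → multiplicity _≟Y_ (f x) ys * v x)           ≡⟨ ∑-cong′ xs (λ x → ∑-*ʳ ys (v x) _) ⟨
    ∑ xs (λ x → ∑ ys (λ y → ⟦ does (y ≟Y f x) ⟧ * v x))     ≡⟨ ∑-comm xs ys _ ⟩
    ∑ ys (λ y → ∑ xs (λ x → ⟦ does (y ≟Y f x) ⟧ * v x))     ≡⟨ ∑-cong ys (λ y∈ys → ∑-cong xs (λ x∈xs → matched x∈xs y∈ys)) ⟩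
    ∑ ys (λ y → ∑ xs (λ x → ⟦ does (x ≟X g y) ⟧ * w y))     ≡⟨ ∑-cong′ ys (λ y → ∑-*ʳ xs (w y) _) ⟩
    ∑ ys (λ y → multiplicity _≟X_ (g y) xs * w y)           ≡⟨ ∑-cong ys (λ y∈ys → counted (proj₁ ∘ back y∈ys)) ⟨
    ∑ ys w                                                   ∎
    where
    open ≡-Reasoning
    counted : ∀ {a c} → (a ≢ 0 → c ≡ 1) → a ≡ c * a
    counted {zero} {c} _ = sym (*-zeroʳ c)
    counted {suc a} c≡1 rewrite c≡1 (λ ()) = sym (+-identityʳ (suc a))
    matched : ∀ {x y} → x ∈ xs → y ∈ ys → ⟦ does (y ≟Y f x) ⟧ * v x ≡ ⟦ does (x ≟X g y) ⟧ * w y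
    matched x∈xs y∈ys = ⟦does⟧-*-transfer (_ ≟Y _) (_ ≟X _)
      (λ vx≢0 → λ { refl → let _ , gfx≡x , w≡v = forth x∈xs vx≢0 in sym gfx≡x , w≡v })
      (λ wy≢0 → λ { refl → let _ , fgy≡y , v≡w = back y∈ys wy≢0 in sym fgy≡y , v≡w })

∈-range⁺ : ∀ {lo hi m} → lo ≤ m → m ≤ hi → m ∈ range lo hi
∈-range⁺ {lo} {hi} {m} lo≤m m≤hi =
  subst (_∈ range lo hi) (m+[n∸m]≡n lo≤m) (∈-map⁺ (lo +_) (∈-upTo⁺ (s≤s (∸-monoˡ-≤ lo m≤hi))))

∈-range⁻ : ∀ {lo hi m} → m ∈ range lo hi → lo ≤ m × (lo ≤ hi → m ≤ hi)
∈-range⁻ {lo} {hi} m∈range with ∈-map⁻ (lo +_) m∈range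
... | k , k∈upTo , refl = m≤m+n lo k , λ lo≤hi → begin
  lo + k              ≤⟨ +-monoʳ-≤ lo (≤-pred (∈-upTo⁻ k∈upTo)) ⟩
  lo + (hi ∸ lo)      ≡⟨ m+[n∸m]≡n lo≤hi ⟩
  hi                  ∎
  where open ≤-Reasoning

multiplicity-range : ∀ {lo hi m} → lo ≤ m → m ≤ hi → multiplicity _≟_ m (range lo hi) ≡ 1
multiplicity-range lo≤m m≤hi =
  multiplicity-unique _≟_ (Unique.map⁺ (+-cancelˡ-≡ _ _ _) (Unique.upTo⁺ _)) (∈-range⁺ lo≤m m≤hi)

_≟ₗ_ : DecidableEquality (List ℕ)
_≟ₗ_ = ≡-dec _≟_

_⊗_ : List X → List (List X) → List (List X)
ms ⊗ μs = concatMap (λ m → map (m ∷_) μs) ms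

∈-⊗⁻ : (ms : List X) (μs : List (List X)) {ν : List X} →
  ν ∈ ms ⊗ μs → ∃ λ m → ∃ λ μ → m ∈ ms × μ ∈ μs × ν ≡ m ∷ μ
∈-⊗⁻ ms μs ν∈ with find (∈-concatMap⁻ (λ m → map (m ∷_) μs) {xs = ms} ν∈)
... | m , m∈ms , ν∈m∷μs with ∈-map⁻ (m ∷_) ν∈m∷μs
... | μ , μ∈μs , ν≡m∷μ = m , μ , m∈ms , μ∈μs , ν≡m∷μ

∑-⊗ : (ms : List X) (μs : List (List X)) (w : List X → ℕ) →
  ∑ (ms ⊗ μs) w ≡ ∑ ms (λ m → ∑ μs (λ μ → w (m ∷ μ)))
∑-⊗ ms μs w = trans (∑-concatMap _ ms w) (∑-cong′ ms (λ m → ∑-map (m ∷_) μs w))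

multiplicity-⊗ : (m : ℕ) (μ : List ℕ) (ms : List ℕ) (μs : List (List ℕ)) →
  multiplicity _≟ₗ_ (m ∷ μ) (ms ⊗ μs) ≡ multiplicity _≟_ m ms * multiplicity _≟ₗ_ μ μs
multiplicity-⊗ m μ ms μs =
  trans (multiplicity-concatMap _≟_ _≟ₗ_ (λ k → map (k ∷_) μs) head₀ head₀-∈ (m ∷ μ) ms)
    (cong (multiplicity _≟_ m ms *_) (trans (∑-map (m ∷_) μs _) (∑-cong′ μs tail-≟)))
  where
  head₀ : List ℕ → ℕ
  head₀ [] = 0
  head₀ (k ∷ _) = k
  head₀-∈ : ∀ k {ν} → ν ∈ map (k ∷_) μs → head₀ ν ≡ k
  head₀-∈ k ν∈ with ∈-map⁻ (k ∷_) ν∈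
  ... | _ , _ , refl = refl
  tail-≟ : ∀ κ → ⟦ does ((m ∷ κ) ≟ₗ (m ∷ μ)) ⟧ ≡ ⟦ does (κ ≟ₗ μ) ⟧
  tail-≟ κ = ⟦does⟧-cong ((m ∷ κ) ≟ₗ (m ∷ μ)) (κ ≟ₗ μ) (proj₂ ∘ ∷-injective) (cong (m ∷_))

dependentPairs : List X → (X → List Y) → List (X × Y)
dependentPairs xs f = concatMap (λ x → map (x ,_) (f x)) xs

∑-dependentPairs : (xs : List X) (f : X → List Y) (c : X → ℕ) (w : X → Y → ℕ) →
  ∑ xs (λ x → c x * ∑ (f x) (w x)) ≡ ∑ (dependentPairs xs f) (λ (x , y) → c x * w x y)
∑-dependentPairs xs f c w = sym (trans (∑-concatMap _ xs _)
  (∑-cong′ xs (λ x → trans (∑-map (x ,_) (f x) _) (∑-*ˡ (f x) (c x) (w x)))))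

∈-dependentPairs⁻ : (xs : List X) (f : X → List Y) {p : X × Y} →
  p ∈ dependentPairs xs f → proj₁ p ∈ xs × proj₂ p ∈ f (proj₁ p)
∈-dependentPairs⁻ xs f p∈ with find (∈-concatMap⁻ (λ x → map (x ,_) (f x)) {xs = xs} p∈)
... | x , x∈xs , p∈x,fx with ∈-map⁻ (x ,_) p∈x,fx
... | y , y∈fx , refl = x∈xs , y∈fx

multiplicity-dependentPairs : {X Y : Set} (_≟X_ : DecidableEquality X) (_≟Y_ : DecidableEquality Y)
  (xs : List X) (f : X → List Y) (x : X) (y : Y) →
  multiplicity (×-≡-dec _≟X_ _≟Y_) (x , y) (dependentPairs xs f) ≡
  multiplicity _≟X_ x xs * multiplicity _≟Y_ y (f x)
multiplicity-dependentPairs {X} {Y} _≟X_ _≟Y_ xs f x y =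
  trans (multiplicity-concatMap _≟X_ _≟×_ (λ x → map (x ,_) (f x)) proj₁ first-∈ (x , y) xs)
    (cong (multiplicity _≟X_ x xs *_) (trans (∑-map (x ,_) (f x) _) (∑-cong′ (f x) second-≟)))
  where
  _≟×_ : DecidableEquality (X × Y)
  _≟×_ = ×-≡-dec _≟X_ _≟Y_
  first-∈ : ∀ x′ {p} → p ∈ map (x′ ,_) (f x′) → proj₁ p ≡ x′
  first-∈ x′ p∈ with ∈-map⁻ (x′ ,_) p∈
  ... | _ , _ , refl = refl
  second-≟ : ∀ y′ → ⟦ does ((x , y′) ≟× (x , y)) ⟧ ≡ ⟦ does (y′ ≟Y y) ⟧
  second-≟ y′ = ⟦does⟧-cong ((x , y′) ≟× (x , y)) (y′ ≟Y y) (proj₂ ∘ ,-injective) (cong (x ,_))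

boxes : List ℕ → List (List ℕ)
boxes [] = [] ∷ []
boxes (b ∷ bs) = range 0 b ⊗ boxes bs

boxes-length : ∀ bs {xs} → xs ∈ boxes bs → length xs ≡ length bs
boxes-length [] (here refl) = refl
boxes-length (b ∷ bs) xs∈ with ∈-⊗⁻ (range 0 b) (boxes bs) xs∈
... | _ , _ , _ , xs∈ , refl = cong suc (boxes-length bs xs∈)

multiplicity-boxes : ∀ {xs bs} → Pointwise _≤_ xs bs → multiplicity _≟ₗ_ xs (boxes bs) ≡ 1
multiplicity-boxes [] = refl
multiplicity-boxes {x ∷ xs} {b ∷ bs} (x≤b ∷ xs≤bs) =
  trans (multiplicity-⊗ x xs (range 0 b) (boxes bs))
    (cong₂ _*_ (multiplicity-range z≤n x≤b) (multiplicity-boxes xs≤bs))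

enumerate : List ℕ → (List ℕ → X) → List X
enumerate [] k = k [] ∷ []
enumerate (b ∷ []) k = map (λ x → k (x ∷ [])) (range 0 b)
enumerate (b ∷ b′ ∷ bs) k = concatMap (λ x → enumerate (b′ ∷ bs) (λ xs → k (x ∷ xs))) (range 0 b)

∑-enumerate : ∀ bs (k : List ℕ → X) (w : X → ℕ) → ∑ (enumerate bs k) w ≡ ∑ (boxes bs) (w ∘ k)
∑-enumerate [] k w = refl
∑-enumerate (b ∷ []) k w =
  trans (∑-map (λ x → k (x ∷ [])) (range 0 b) w)
    (trans (∑-cong′ (range 0 b) (λ x → sym (+-identityʳ _))) (sym (∑-⊗ (range 0 b) (boxes []) (w ∘ k))))
∑-enumerate (b ∷ b′ ∷ bs) k w =
  trans (∑-concatMap (λ x → enumerate (b′ ∷ bs) (λ xs → k (x ∷ xs))) (range 0 b) w)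
    (trans (∑-cong′ (range 0 b) (λ x → ∑-enumerate (b′ ∷ bs) (λ xs → k (x ∷ xs)) w))
      (sym (∑-⊗ (range 0 b) (boxes (b′ ∷ bs)) (w ∘ k))))

-- Horizontal strips and Pieri coefficients

Interlaces : List ℕ → List ℕ → Set
Interlaces [] [] = ⊤
Interlaces (x ∷ []) (m ∷ []) = m ≤ x
Interlaces (x ∷ y ∷ ν) (m ∷ μ) = y ≤ m × m ≤ x × Interlaces (y ∷ ν) μ
Interlaces _ _ = ⊥

NonIncreasing : List ℕ → Set
NonIncreasing = Linked _≥_

strips-sound : ∀ ν {μ} → NonIncreasing ν → μ ∈ strips ν → Interlaces ν μ
strips-sound [] _ (here refl) = tt
strips-sound (x ∷ []) _ μ∈ with ∈-map⁻ (_∷ []) μ∈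
... | m , m∈ , refl = proj₂ (∈-range⁻ m∈) z≤n
strips-sound (x ∷ y ∷ ν) (y≤x ∷ ν↓) μ∈ with ∈-⊗⁻ (range y x) (strips (y ∷ ν)) μ∈
... | m , μ , m∈ , μ∈ , refl = proj₁ (∈-range⁻ m∈) , proj₂ (∈-range⁻ m∈) y≤x , strips-sound (y ∷ ν) ν↓ μ∈

Interlaces-nonIncreasing : ∀ ν μ → Interlaces ν μ → NonIncreasing μ
Interlaces-nonIncreasing [] [] _ = []
Interlaces-nonIncreasing (x ∷ []) (m ∷ []) _ = [-]
Interlaces-nonIncreasing (x ∷ y ∷ []) (m ∷ m′ ∷ []) (y≤m , _ , m′≤y) = ≤-trans m′≤y y≤m ∷ [-]
Interlaces-nonIncreasing (x ∷ y ∷ z ∷ ν) (m ∷ m′ ∷ μ) (y≤m , _ , ν⊒μ@(_ , m′≤y , _)) =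
  ≤-trans m′≤y y≤m ∷ Interlaces-nonIncreasing (y ∷ z ∷ ν) (m′ ∷ μ) ν⊒μ

Interlaces-length : ∀ ν μ → Interlaces ν μ → length μ ≡ length ν
Interlaces-length [] [] _ = refl
Interlaces-length (x ∷ []) (m ∷ []) _ = refl
Interlaces-length (x ∷ y ∷ ν) (m ∷ μ) (_ , _ , ν⊒μ) = cong suc (Interlaces-length (y ∷ ν) μ ν⊒μ)

multiplicity-strips : ∀ ν μ → Interlaces ν μ → multiplicity _≟ₗ_ μ (strips ν) ≡ 1
multiplicity-strips [] [] _ = refl
multiplicity-strips (x ∷ []) (m ∷ []) m≤x = begin
  multiplicity _≟ₗ_ (m ∷ []) (map (_∷ []) (range 0 x))  ≡⟨ ∑-map (_∷ []) (range 0 x) _ ⟩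
  ∑ (range 0 x) (λ k → ⟦ does ((k ∷ []) ≟ₗ (m ∷ [])) ⟧) ≡⟨ ∑-cong′ (range 0 x) singleton-≟ ⟩
  multiplicity _≟_ m (range 0 x)                         ≡⟨ multiplicity-range z≤n m≤x ⟩
  1                                                      ∎
  where
  open ≡-Reasoning
  singleton-≟ : ∀ k → ⟦ does ((k ∷ []) ≟ₗ (m ∷ [])) ⟧ ≡ ⟦ does (k ≟ m) ⟧
  singleton-≟ k = ⟦does⟧-cong ((k ∷ []) ≟ₗ (m ∷ [])) (k ≟ m) (proj₁ ∘ ∷-injective) (cong (_∷ []))
multiplicity-strips (x ∷ y ∷ ν) (m ∷ μ) (y≤m , m≤x , ν⊒μ) =
  trans (multiplicity-⊗ m μ (range y x) (strips (y ∷ ν)))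
    (cong₂ _*_ (multiplicity-range y≤m m≤x) (multiplicity-strips (y ∷ ν) μ ν⊒μ))

pieriCoeff-∷ : ∀ a as ν →
  pieriCoeff (a ∷ as) ν ≡ ∑ (strips ν) (λ μ → ⟦ size ν ≡ᵇ size μ + a ⟧ * pieriCoeff as μ)
pieriCoeff-∷ a as ν = ∑-filterᵇ _ (strips ν) (pieriCoeff as)

PositiveAt : ℕ → List ℕ → Set
PositiveAt _ [] = ⊥
PositiveAt zero (x ∷ _) = 0 < x
PositiveAt (suc k) (_ ∷ ν) = PositiveAt k ν

strips-PositiveAt : ∀ k ν {μ} → μ ∈ strips ν → PositiveAt (suc k) ν → PositiveAt k μ
strips-PositiveAt zero (x ∷ y ∷ ν) μ∈ 0<y with ∈-⊗⁻ (range y x) (strips (y ∷ ν)) μ∈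
... | m , _ , m∈ , _ , refl = <-≤-trans 0<y (proj₁ (∈-range⁻ m∈))
strips-PositiveAt (suc k) (x ∷ y ∷ ν) μ∈ pos with ∈-⊗⁻ (range y x) (strips (y ∷ ν)) μ∈
... | _ , μ , _ , μ∈ , refl = strips-PositiveAt k (y ∷ ν) μ∈ pos

pieriCoeff-vanish : ∀ cs ν → PositiveAt (length cs) ν → pieriCoeff cs ν ≡ 0
pieriCoeff-vanish [] (suc x ∷ ν) _ = refl
pieriCoeff-vanish (a ∷ as) ν pos = trans (pieriCoeff-∷ a as ν) (∑-zero (strips ν) vanishes)
  where
  vanishes : ∀ {μ} → μ ∈ strips ν → ⟦ size ν ≡ᵇ size μ + a ⟧ * pieriCoeff as μ ≡ 0
  vanishes {μ} μ∈ = trans (cong (⟦ size ν ≡ᵇ size μ + a ⟧ *_)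
    (pieriCoeff-vanish as μ (strips-PositiveAt (length as) ν μ∈ pos))) (*-zeroʳ ⟦ size ν ≡ᵇ size μ + a ⟧)

∑-strips-++-0 : ∀ ν (w : List ℕ → ℕ) →
  ∑ (strips (ν ++ 0 ∷ [])) w ≡ ∑ (strips ν) (λ μ → w (μ ++ 0 ∷ []))
∑-strips-++-0 [] w = refl
∑-strips-++-0 (x ∷ []) w =
  trans (∑-⊗ (range 0 x) (strips (0 ∷ [])) w)
    (trans (∑-cong′ (range 0 x) (λ m → +-identityʳ (w (m ∷ 0 ∷ []))))
      (sym (∑-map (_∷ []) (range 0 x) (λ μ → w (μ ++ 0 ∷ [])))))
∑-strips-++-0 (x ∷ y ∷ ν) w =
  trans (∑-⊗ (range y x) (strips (y ∷ ν ++ 0 ∷ [])) w)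
    (trans (∑-cong′ (range y x) (λ m → ∑-strips-++-0 (y ∷ ν) (λ μ → w (m ∷ μ))))
      (sym (∑-⊗ (range y x) (strips (y ∷ ν)) (λ μ → w (μ ++ 0 ∷ [])))))

size-++-0 : ∀ ν → size (ν ++ 0 ∷ []) ≡ size ν
size-++-0 [] = refl
size-++-0 (x ∷ ν) = cong (x +_) (size-++-0 ν)

allZeroᵇ-++-0 : ∀ ν → allZeroᵇ (ν ++ 0 ∷ []) ≡ allZeroᵇ ν
allZeroᵇ-++-0 [] = refl
allZeroᵇ-++-0 (x ∷ ν) = cong ((x ≡ᵇ 0) ∧_) (allZeroᵇ-++-0 ν)

pieriCoeff-++-0 : ∀ cs ν → pieriCoeff cs (ν ++ 0 ∷ []) ≡ pieriCoeff cs ν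
pieriCoeff-++-0 [] ν rewrite allZeroᵇ-++-0 ν = refl
pieriCoeff-++-0 (a ∷ as) ν = begin
  pieriCoeff (a ∷ as) (ν ++ 0 ∷ [])
    ≡⟨ pieriCoeff-∷ a as (ν ++ 0 ∷ []) ⟩
  ∑ (strips (ν ++ 0 ∷ [])) (λ μ → ⟦ size (ν ++ 0 ∷ []) ≡ᵇ size μ + a ⟧ * pieriCoeff as μ)
    ≡⟨ ∑-strips-++-0 ν _ ⟩
  ∑ (strips ν) (λ μ → ⟦ size (ν ++ 0 ∷ []) ≡ᵇ size (μ ++ 0 ∷ []) + a ⟧ * pieriCoeff as (μ ++ 0 ∷ []))
    ≡⟨ ∑-cong′ (strips ν) drop-0 ⟩
  ∑ (strips ν) (λ μ → ⟦ size ν ≡ᵇ size μ + a ⟧ * pieriCoeff as μ)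
    ≡⟨ pieriCoeff-∷ a as ν ⟨
  pieriCoeff (a ∷ as) ν ∎
  where
  open ≡-Reasoning
  drop-0 : ∀ μ → ⟦ size (ν ++ 0 ∷ []) ≡ᵇ size (μ ++ 0 ∷ []) + a ⟧ * pieriCoeff as (μ ++ 0 ∷ []) ≡
                 ⟦ size ν ≡ᵇ size μ + a ⟧ * pieriCoeff as μ
  drop-0 μ rewrite size-++-0 ν | size-++-0 μ = cong (⟦ size ν ≡ᵇ size μ + a ⟧ *_) (pieriCoeff-++-0 as μ)

pieriCoeff-padding : ∀ cs ν k → pieriCoeff cs (ν ++ replicate k 0) ≡ pieriCoeff cs ν
pieriCoeff-padding cs ν zero = cong (pieriCoeff cs) (++-identityʳ ν)
pieriCoeff-padding cs ν (suc k) = begin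
  pieriCoeff cs (ν ++ 0 ∷ replicate k 0)     ≡⟨ cong (pieriCoeff cs) (++-assoc ν (0 ∷ []) (replicate k 0)) ⟨
  pieriCoeff cs ((ν ++ 0 ∷ []) ++ replicate k 0) ≡⟨ pieriCoeff-padding cs (ν ++ 0 ∷ []) k ⟩
  pieriCoeff cs (ν ++ 0 ∷ [])                ≡⟨ pieriCoeff-++-0 cs ν ⟩
  pieriCoeff cs ν                            ∎
  where open ≡-Reasoning

-- Symmetry of Pieri coefficients: the Bender–Knuth involution

reflect : ℕ → ℕ → ℕ → ℕ
reflect lo hi m = lo + hi ∸ m

module _ {lo hi m : ℕ} where

  reflect-lower : m ≤ hi → lo ≤ reflect lo hi m
  reflect-lower m≤hi = subst (lo ≤_) (sym (+-∸-assoc lo m≤hi)) (m≤m+n lo (hi ∸ m))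

  reflect-upper : lo ≤ m → reflect lo hi m ≤ hi
  reflect-upper lo≤m = ≤-trans (∸-monoʳ-≤ (lo + hi) lo≤m) (≤-reflexive (m+n∸m≡n lo hi))

  reflect-+ : m ≤ hi → reflect lo hi m + m ≡ lo + hi
  reflect-+ m≤hi = m∸n+n≡m (≤-trans m≤hi (m≤n+m hi lo))

  reflect-involutive : m ≤ hi → reflect lo hi (reflect lo hi m) ≡ m
  reflect-involutive m≤hi = begin
    lo + hi ∸ (lo + hi ∸ m)                   ≡⟨ cong (_∸ (lo + hi ∸ m)) (reflect-+ m≤hi) ⟨
    (lo + hi ∸ m) + m ∸ (lo + hi ∸ m)         ≡⟨ m+n∸m≡n (lo + hi ∸ m) m ⟩
    m                                         ∎
    where open ≡-Reasoning

m⊔n+m⊓n≡m+n : ∀ a b → a ⊔ b + a ⊓ b ≡ a + b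
m⊔n+m⊓n≡m+n a b with ≤-total a b
... | inj₁ a≤b rewrite m≤n⇒m⊔n≡n a≤b | m≤n⇒m⊓n≡m a≤b = +-comm b a
... | inj₂ b≤a rewrite m≥n⇒m⊔n≡m b≤a | m≥n⇒m⊓n≡n b≤a = refl

_≟₂_ : DecidableEquality (List ℕ × List ℕ)
_≟₂_ = ×-≡-dec _≟ₗ_ _≟ₗ_

twoStrips : List ℕ → List (List ℕ × List ℕ)
twoStrips ν = dependentPairs (strips ν) strips

twoStrips-sound : ∀ ν {μ κ} → NonIncreasing ν → (μ , κ) ∈ twoStrips ν → Interlaces ν μ × Interlaces μ κ
twoStrips-sound ν {μ} ν↓ p∈ with ∈-dependentPairs⁻ (strips ν) strips p∈
... | μ∈ , κ∈ = ν⊒μ , strips-sound μ (Interlaces-nonIncreasing ν μ ν⊒μ) κ∈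
  where
  ν⊒μ : Interlaces ν μ
  ν⊒μ = strips-sound ν ν↓ μ∈

multiplicity-twoStrips : ∀ ν μ κ → Interlaces ν μ → Interlaces μ κ →
  multiplicity _≟₂_ (μ , κ) (twoStrips ν) ≡ 1
multiplicity-twoStrips ν μ κ ν⊒μ μ⊒κ =
  trans (multiplicity-dependentPairs _≟ₗ_ _≟ₗ_ (strips ν) strips μ κ)
    (cong₂ _*_ (multiplicity-strips ν μ ν⊒μ) (multiplicity-strips μ κ μ⊒κ))

weight₂ : ℕ → ℕ → (List ℕ → ℕ) → List ℕ → List ℕ × List ℕ → ℕ
weight₂ a b P ν (μ , κ) = ⟦ size ν ≡ᵇ size μ + a ⟧ * (⟦ size μ ≡ᵇ size κ + b ⟧ * P κ)

pieriCoeff-∷∷ : ∀ a b cs ν → pieriCoeff (a ∷ b ∷ cs) ν ≡ ∑ (twoStrips ν) (weight₂ a b (pieriCoeff cs) ν)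
pieriCoeff-∷∷ a b cs ν =
  trans (pieriCoeff-∷ a (b ∷ cs) ν)
    (trans (∑-cong′ (strips ν) (λ μ → cong (⟦ size ν ≡ᵇ size μ + a ⟧ *_) (pieriCoeff-∷ b cs μ)))
      (∑-dependentPairs (strips ν) strips (λ μ → ⟦ size ν ≡ᵇ size μ + a ⟧)
        (λ μ κ → ⟦ size μ ≡ᵇ size κ + b ⟧ * pieriCoeff cs κ)))

weight₂-sizes : ∀ a b P ν μ κ → weight₂ a b P ν (μ , κ) ≢ 0 → size ν ≡ size μ + a × size μ ≡ size κ + b
weight₂-sizes a b P ν μ κ ≢0 =
  let ν≡ , ≢0′ = ⟦does⟧*-≢0 (size ν ≟ size μ + a) _ ≢0
  in ν≡ , proj₁ (⟦does⟧*-≢0 (size μ ≟ size κ + b) _ ≢0′)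

weight₂-sizes⁻ : ∀ a b P ν μ κ → size ν ≡ size μ + a → size μ ≡ size κ + b →
  weight₂ a b P ν (μ , κ) ≡ P κ
weight₂-sizes⁻ a b P ν μ κ ν≡ μ≡
  rewrite ⟦does⟧-yes (size ν ≟ size μ + a) ν≡ | ⟦does⟧-yes (size μ ≟ size κ + b) μ≡ =
  trans (+-identityʳ _) (+-identityʳ (P κ))

-- Each part of the middle partition μ is reflected inside the interval allowed by ν and κ; this
-- exchanges the sizes of the strips ν/μ and μ/κ.
bk₄ : List ℕ → List ℕ → List ℕ → List ℕ
bk₄ (x₁ ∷ x₂ ∷ x₃ ∷ x₄ ∷ []) (m₁ ∷ m₂ ∷ m₃ ∷ m₄ ∷ []) (k₁ ∷ k₂ ∷ k₃ ∷ k₄ ∷ []) =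
  reflect (x₂ ⊔ k₁) x₁ m₁ ∷ reflect (x₃ ⊔ k₂) (x₂ ⊓ k₁) m₂ ∷
  reflect (x₄ ⊔ k₃) (x₃ ⊓ k₂) m₃ ∷ reflect k₄ (x₄ ⊓ k₃) m₄ ∷ []
bk₄ _ μ _ = μ

InBox : List ℕ → List ℕ → List ℕ → Set
InBox (x₁ ∷ x₂ ∷ x₃ ∷ x₄ ∷ []) (r₁ ∷ r₂ ∷ r₃ ∷ r₄ ∷ []) (k₁ ∷ k₂ ∷ k₃ ∷ k₄ ∷ []) =
  (x₂ ⊔ k₁ ≤ r₁ × r₁ ≤ x₁) × (x₃ ⊔ k₂ ≤ r₂ × r₂ ≤ x₂ ⊓ k₁) ×
  (x₄ ⊔ k₃ ≤ r₃ × r₃ ≤ x₃ ⊓ k₂) × (k₄ ≤ r₄ × r₄ ≤ x₄ ⊓ k₃)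
InBox _ _ _ = ⊥

interlacing⇒InBox : ∀ {x₁ x₂ x₃ x₄} μ κ → Interlaces (x₁ ∷ x₂ ∷ x₃ ∷ x₄ ∷ []) μ → Interlaces μ κ →
  InBox (x₁ ∷ x₂ ∷ x₃ ∷ x₄ ∷ []) μ κ
interlacing⇒InBox (m₁ ∷ m₂ ∷ m₃ ∷ m₄ ∷ []) (k₁ ∷ k₂ ∷ k₃ ∷ k₄ ∷ [])
  (a₁ , a₂ , a₃ , a₄ , a₅ , a₆ , a₇) (b₁ , b₂ , b₃ , b₄ , b₅ , b₆ , b₇) =
  (⊔-lub a₁ b₂ , a₂) , (⊔-lub a₃ b₄ , ⊓-glb a₄ b₁) , (⊔-lub a₅ b₆ , ⊓-glb a₆ b₃) , (b₇ , ⊓-glb a₇ b₅)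

InBox⇒interlacing : ∀ ν ρ κ → InBox ν ρ κ → Interlaces ν ρ × Interlaces ρ κ
InBox⇒interlacing (x₁ ∷ x₂ ∷ x₃ ∷ x₄ ∷ []) (r₁ ∷ r₂ ∷ r₃ ∷ r₄ ∷ []) (k₁ ∷ k₂ ∷ k₃ ∷ k₄ ∷ [])
  ((c₁ , c₂) , (c₃ , c₄) , (c₅ , c₆) , (c₇ , c₈)) =
  (≤-trans (m≤m⊔n x₂ k₁) c₁ , c₂ , ≤-trans (m≤m⊔n x₃ k₂) c₃ , ≤-trans c₄ (m⊓n≤m x₂ k₁) ,
     ≤-trans (m≤m⊔n x₄ k₃) c₅ , ≤-trans c₆ (m⊓n≤m x₃ k₂) , ≤-trans c₈ (m⊓n≤m x₄ k₃)) ,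
  (≤-trans c₄ (m⊓n≤n x₂ k₁) , ≤-trans (m≤n⊔m x₂ k₁) c₁ , ≤-trans c₆ (m⊓n≤n x₃ k₂) ,
     ≤-trans (m≤n⊔m x₃ k₂) c₃ , ≤-trans c₈ (m⊓n≤n x₄ k₃) , ≤-trans (m≤n⊔m x₄ k₃) c₅ , c₇)

bk₄-InBox : ∀ ν μ κ → InBox ν μ κ → InBox ν (bk₄ ν μ κ) κ
bk₄-InBox (_ ∷ _ ∷ _ ∷ _ ∷ []) (_ ∷ _ ∷ _ ∷ _ ∷ []) (_ ∷ _ ∷ _ ∷ _ ∷ [])
  ((c₁ , c₂) , (c₃ , c₄) , (c₅ , c₆) , (c₇ , c₈)) =
  (reflect-lower c₂ , reflect-upper c₁) , (reflect-lower c₄ , reflect-upper c₃) ,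
  (reflect-lower c₆ , reflect-upper c₅) , (reflect-lower c₈ , reflect-upper c₇)

bk₄-involutive : ∀ ν μ κ → InBox ν μ κ → bk₄ ν (bk₄ ν μ κ) κ ≡ μ
bk₄-involutive (_ ∷ _ ∷ _ ∷ _ ∷ []) (_ ∷ _ ∷ _ ∷ _ ∷ []) (_ ∷ _ ∷ _ ∷ _ ∷ [])
  ((_ , c₂) , (_ , c₄) , (_ , c₆) , (_ , c₈)) =
  cong₂ _∷_ (reflect-involutive c₂) (cong₂ _∷_ (reflect-involutive c₄)
    (cong₂ _∷_ (reflect-involutive c₆) (cong₂ _∷_ (reflect-involutive c₈) refl)))

bk₄-size : ∀ ν μ κ → InBox ν μ κ → size (bk₄ ν μ κ) + size μ ≡ size ν + size κ
bk₄-size (x₁ ∷ x₂ ∷ x₃ ∷ x₄ ∷ []) (m₁ ∷ m₂ ∷ m₃ ∷ m₄ ∷ []) (k₁ ∷ k₂ ∷ k₃ ∷ k₄ ∷ [])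
  ((_ , c₂) , (_ , c₄) , (_ , c₆) , (_ , c₈)) = begin
  (r₁ + (r₂ + (r₃ + (r₄ + 0)))) + (m₁ + (m₂ + (m₃ + (m₄ + 0))))
    ≡⟨ solve 8 (λ r₁ r₂ r₃ r₄ m₁ m₂ m₃ m₄ →
         (r₁ :+ (r₂ :+ (r₃ :+ (r₄ :+ con 0)))) :+ (m₁ :+ (m₂ :+ (m₃ :+ (m₄ :+ con 0))))
           := (r₁ :+ m₁) :+ (r₂ :+ m₂) :+ (r₃ :+ m₃) :+ (r₄ :+ m₄)) refl r₁ r₂ r₃ r₄ m₁ m₂ m₃ m₄ ⟩
  (r₁ + m₁) + (r₂ + m₂) + (r₃ + m₃) + (r₄ + m₄)
    ≡⟨ cong₂ _+_ (cong₂ _+_ (cong₂ _+_ (reflect-+ c₂) (reflect-+ c₄)) (reflect-+ c₆)) (reflect-+ c₈) ⟩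
  (x₂ ⊔ k₁ + x₁) + (x₃ ⊔ k₂ + x₂ ⊓ k₁) + (x₄ ⊔ k₃ + x₃ ⊓ k₂) + (k₄ + x₄ ⊓ k₃)
    ≡⟨ solve 8 (λ A A′ B B′ C C′ x₁ k₄ → (A :+ x₁) :+ (B :+ A′) :+ (C :+ B′) :+ (k₄ :+ C′)
         := x₁ :+ (A :+ A′) :+ (B :+ B′) :+ (C :+ C′) :+ k₄) refl
         (x₂ ⊔ k₁) (x₂ ⊓ k₁) (x₃ ⊔ k₂) (x₃ ⊓ k₂) (x₄ ⊔ k₃) (x₄ ⊓ k₃) x₁ k₄ ⟩
  x₁ + (x₂ ⊔ k₁ + x₂ ⊓ k₁) + (x₃ ⊔ k₂ + x₃ ⊓ k₂) + (x₄ ⊔ k₃ + x₄ ⊓ k₃) + k₄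
    ≡⟨ cong (_+ k₄) (cong₂ _+_ (cong₂ _+_ (cong (x₁ +_) (m⊔n+m⊓n≡m+n x₂ k₁)) (m⊔n+m⊓n≡m+n x₃ k₂)) (m⊔n+m⊓n≡m+n x₄ k₃)) ⟩
  x₁ + (x₂ + k₁) + (x₃ + k₂) + (x₄ + k₃) + k₄
    ≡⟨ solve 8 (λ x₁ x₂ x₃ x₄ k₁ k₂ k₃ k₄ → x₁ :+ (x₂ :+ k₁) :+ (x₃ :+ k₂) :+ (x₄ :+ k₃) :+ k₄
         := (x₁ :+ (x₂ :+ (x₃ :+ (x₄ :+ con 0)))) :+ (k₁ :+ (k₂ :+ (k₃ :+ (k₄ :+ con 0))))) refl
         x₁ x₂ x₃ x₄ k₁ k₂ k₃ k₄ ⟩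
  (x₁ + (x₂ + (x₃ + (x₄ + 0)))) + (k₁ + (k₂ + (k₃ + (k₄ + 0)))) ∎
  where
  open ≡-Reasoning
  r₁ r₂ r₃ r₄ : ℕ
  r₁ = reflect (x₂ ⊔ k₁) x₁ m₁
  r₂ = reflect (x₃ ⊔ k₂) (x₂ ⊓ k₁) m₂
  r₃ = reflect (x₄ ⊔ k₃) (x₃ ⊓ k₂) m₃
  r₄ = reflect k₄ (x₄ ⊓ k₃) m₄

exchange-sizes : ∀ {n m k r a b : ℕ} → r + m ≡ n + k → n ≡ m + a → m ≡ k + b → r ≡ k + a × n ≡ r + b
exchange-sizes {n} {m} {k} {r} {a} {b} r+m≡n+k n≡m+a m≡k+b = r≡k+a , n≡r+b
  where
  r≡k+a : r ≡ k + a
  r≡k+a = +-cancelʳ-≡ m r (k + a) (begin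
    r + m          ≡⟨ r+m≡n+k ⟩
    n + k          ≡⟨ cong (_+ k) n≡m+a ⟩
    m + a + k      ≡⟨ solve 3 (λ m a k → m :+ a :+ k := k :+ a :+ m) refl m a k ⟩
    k + a + m      ∎)
    where open ≡-Reasoning
  n≡r+b : n ≡ r + b
  n≡r+b = begin
    n              ≡⟨ n≡m+a ⟩
    m + a          ≡⟨ cong (_+ a) m≡k+b ⟩
    k + b + a      ≡⟨ solve 3 (λ k b a → k :+ b :+ a := k :+ a :+ b) refl k b a ⟩
    k + a + b      ≡⟨ cong (_+ b) r≡k+a ⟨
    r + b          ∎
    where open ≡-Reasoning

bkPair : List ℕ → List ℕ × List ℕ → List ℕ × List ℕ
bkPair ν (μ , κ) = bk₄ ν μ κ , κ

bkPair-transported : ∀ a b P x₁ x₂ x₃ x₄ → NonIncreasing (x₁ ∷ x₂ ∷ x₃ ∷ x₄ ∷ []) →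
  let ν = x₁ ∷ x₂ ∷ x₃ ∷ x₄ ∷ [] in
  ∀ {p} → p ∈ twoStrips ν → weight₂ a b P ν p ≢ 0 →
  Transported _≟₂_ (bkPair ν) (bkPair ν) (twoStrips ν) (weight₂ b a P ν) p (weight₂ a b P ν p)
bkPair-transported a b P x₁ x₂ x₃ x₄ ν↓ {μ , κ} p∈ ≢0 =
  multiplicity-twoStrips ν ρ κ ν⊒ρ ρ⊒κ ,
  cong (_, κ) (bk₄-involutive ν μ κ box) ,
  trans (weight₂-sizes⁻ b a P ν ρ κ ν≡ρ+b ρ≡κ+a) (sym (weight₂-sizes⁻ a b P ν μ κ ν≡μ+a μ≡κ+b))
  where
  ν ρ : List ℕ
  ν = x₁ ∷ x₂ ∷ x₃ ∷ x₄ ∷ []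
  ρ = bk₄ ν μ κ
  box : InBox ν μ κ
  box = interlacing⇒InBox μ κ (proj₁ (twoStrips-sound ν ν↓ p∈)) (proj₂ (twoStrips-sound ν ν↓ p∈))
  ν⊒ρ : Interlaces ν ρ
  ν⊒ρ = proj₁ (InBox⇒interlacing ν ρ κ (bk₄-InBox ν μ κ box))
  ρ⊒κ : Interlaces ρ κ
  ρ⊒κ = proj₂ (InBox⇒interlacing ν ρ κ (bk₄-InBox ν μ κ box))
  ν≡μ+a : size ν ≡ size μ + a
  ν≡μ+a = proj₁ (weight₂-sizes a b P ν μ κ ≢0)
  μ≡κ+b : size μ ≡ size κ + b
  μ≡κ+b = proj₂ (weight₂-sizes a b P ν μ κ ≢0)
  ρ≡κ+a : size ρ ≡ size κ + a
  ρ≡κ+a = proj₁ (exchange-sizes (bk₄-size ν μ κ box) ν≡μ+a μ≡κ+b)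
  ν≡ρ+b : size ν ≡ size ρ + b
  ν≡ρ+b = proj₂ (exchange-sizes (bk₄-size ν μ κ box) ν≡μ+a μ≡κ+b)

pieriCoeff-swap : ∀ a b cs ν → length ν ≡ 4 → NonIncreasing ν →
  pieriCoeff (a ∷ b ∷ cs) ν ≡ pieriCoeff (b ∷ a ∷ cs) ν
pieriCoeff-swap a b cs ν@(x₁ ∷ x₂ ∷ x₃ ∷ x₄ ∷ []) _ ν↓ = begin
  pieriCoeff (a ∷ b ∷ cs) ν                   ≡⟨ pieriCoeff-∷∷ a b cs ν ⟩
  ∑ (twoStrips ν) (weight₂ a b (pieriCoeff cs) ν) ≡⟨ ∑-bijection _≟₂_ _≟₂_ (twoStrips ν) (twoStrips ν) _ _ (bkPair ν) (bkPair ν)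
                                                     (bkPair-transported a b (pieriCoeff cs) x₁ x₂ x₃ x₄ ν↓)
                                                     (bkPair-transported b a (pieriCoeff cs) x₁ x₂ x₃ x₄ ν↓) ⟩
  ∑ (twoStrips ν) (weight₂ b a (pieriCoeff cs) ν) ≡⟨ pieriCoeff-∷∷ b a cs ν ⟨
  pieriCoeff (b ∷ a ∷ cs) ν                   ∎
  where open ≡-Reasoning

pieriCoeff-transpose : ∀ pre a b cs ν → length ν ≡ 4 → NonIncreasing ν →
  pieriCoeff (pre ++ a ∷ b ∷ cs) ν ≡ pieriCoeff (pre ++ b ∷ a ∷ cs) ν
pieriCoeff-transpose [] a b cs ν = pieriCoeff-swap a b cs ν
pieriCoeff-transpose (c ∷ pre) a b cs ν len ν↓ =
  trans (pieriCoeff-∷ c (pre ++ a ∷ b ∷ cs) ν)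
    (trans (∑-cong (strips ν) transposed) (sym (pieriCoeff-∷ c (pre ++ b ∷ a ∷ cs) ν)))
  where
  transposed : ∀ {μ} → μ ∈ strips ν →
    ⟦ size ν ≡ᵇ size μ + c ⟧ * pieriCoeff (pre ++ a ∷ b ∷ cs) μ ≡
    ⟦ size ν ≡ᵇ size μ + c ⟧ * pieriCoeff (pre ++ b ∷ a ∷ cs) μ
  transposed {μ} μ∈ = cong (⟦ size ν ≡ᵇ size μ + c ⟧ *_)
    (pieriCoeff-transpose pre a b cs μ (trans (Interlaces-length ν μ ν⊒μ) len) (Interlaces-nonIncreasing ν μ ν⊒μ))
    where
    ν⊒μ : Interlaces ν μ
    ν⊒μ = strips-sound ν ν↓ μ∈

pieriCoeff-reverse : ∀ c₁ c₂ c₃ c₄ ν → length ν ≡ 4 → NonIncreasing ν →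
  pieriCoeff (c₁ ∷ c₂ ∷ c₃ ∷ c₄ ∷ []) ν ≡ pieriCoeff (c₄ ∷ c₃ ∷ c₂ ∷ c₁ ∷ []) ν
pieriCoeff-reverse c₁ c₂ c₃ c₄ ν len ν↓ = begin
  pieriCoeff (c₁ ∷ c₂ ∷ c₃ ∷ c₄ ∷ []) ν ≡⟨ τ [] c₁ c₂ (c₃ ∷ c₄ ∷ []) ⟩
  pieriCoeff (c₂ ∷ c₁ ∷ c₃ ∷ c₄ ∷ []) ν ≡⟨ τ (c₂ ∷ []) c₁ c₃ (c₄ ∷ []) ⟩
  pieriCoeff (c₂ ∷ c₃ ∷ c₁ ∷ c₄ ∷ []) ν ≡⟨ τ (c₂ ∷ c₃ ∷ []) c₁ c₄ [] ⟩
  pieriCoeff (c₂ ∷ c₃ ∷ c₄ ∷ c₁ ∷ []) ν ≡⟨ τ [] c₂ c₃ (c₄ ∷ c₁ ∷ []) ⟩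
  pieriCoeff (c₃ ∷ c₂ ∷ c₄ ∷ c₁ ∷ []) ν ≡⟨ τ (c₃ ∷ []) c₂ c₄ (c₁ ∷ []) ⟩
  pieriCoeff (c₃ ∷ c₄ ∷ c₂ ∷ c₁ ∷ []) ν ≡⟨ τ [] c₃ c₄ (c₂ ∷ c₁ ∷ []) ⟩
  pieriCoeff (c₄ ∷ c₃ ∷ c₂ ∷ c₁ ∷ []) ν ∎
  where
  open ≡-Reasoning
  τ : ∀ pre a b cs → pieriCoeff (pre ++ a ∷ b ∷ cs) ν ≡ pieriCoeff (pre ++ b ∷ a ∷ cs) ν
  τ pre a b cs = pieriCoeff-transpose pre a b cs ν len ν↓

-- stripZeros is definitionally filter nonzero?, so the stdlib lemmas on filter apply to it.
nonzero? : (x : ℕ) → Dec (T (not (x ≡ᵇ 0)))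
nonzero? x = T? (not (x ≡ᵇ 0))

stripZeros-∷ : ∀ l {xs ys} → stripZeros xs ≡ stripZeros ys → stripZeros (l ∷ xs) ≡ stripZeros (l ∷ ys)
stripZeros-∷ zero eq = eq
stripZeros-∷ (suc l) eq = cong (suc l ∷_) eq

stripZeros-zeros : ∀ i → stripZeros (replicate i 0) ≡ []
stripZeros-zeros zero = refl
stripZeros-zeros (suc i) = stripZeros-zeros i

stripZeros-++-zeros : ∀ xs i → stripZeros (xs ++ replicate i 0) ≡ stripZeros xs
stripZeros-++-zeros xs i = begin
  filter nonzero? (xs ++ replicate i 0)                       ≡⟨ filter-++ nonzero? xs (replicate i 0) ⟩
  filter nonzero? xs ++ filter nonzero? (replicate i 0)      ≡⟨ cong (filter nonzero? xs ++_) (stripZeros-zeros i) ⟩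
  filter nonzero? xs ++ []                                    ≡⟨ ++-identityʳ _ ⟩
  filter nonzero? xs                                          ∎
  where open ≡-Reasoning

stripZeros-positive : ∀ {ν} → All (0 <_) ν → stripZeros ν ≡ ν
stripZeros-positive ν>0 = filter-all nonzero? (All.map (λ { (s≤s z≤n) → tt }) ν>0)

stripZeros-partition : ∀ ν → NonIncreasing ν → IsPartition (stripZeros ν)
stripZeros-partition ν ν↓ =
  Linked.filter⁺ nonzero? (λ i≥j j≥k → ≤-trans j≥k i≥j) ν↓ ,
  All.map positive (All.all-filter nonzero? ν)
  where
  positive : ∀ {x} → T (not (x ≡ᵇ 0)) → 0 < x
  positive {suc x} _ = s≤s z≤n

zeros-after-0 : ∀ r → NonIncreasing (0 ∷ r) → r ≡ replicate (length r) 0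
zeros-after-0 [] _ = refl
zeros-after-0 (_ ∷ r) (z≤n ∷ 0∷r↓) = cong (0 ∷_) (zeros-after-0 r 0∷r↓)

nonIncreasing-zeros : ∀ s → NonIncreasing s → ∃ λ i → s ≡ stripZeros s ++ replicate i 0
nonIncreasing-zeros [] _ = 0 , refl
nonIncreasing-zeros (zero ∷ r) s↓ = suc (length r) , (begin
  0 ∷ r                                         ≡⟨ cong (0 ∷_) r≡0s ⟩
  replicate (suc (length r)) 0                  ≡⟨ cong (_++ replicate (suc (length r)) 0) strip-r≡[] ⟨
  stripZeros r ++ replicate (suc (length r)) 0  ∎)
  where
  open ≡-Reasoning
  r≡0s : r ≡ replicate (length r) 0
  r≡0s = zeros-after-0 r s↓
  strip-r≡[] : stripZeros r ≡ []
  strip-r≡[] = trans (cong stripZeros r≡0s) (stripZeros-zeros (length r))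
nonIncreasing-zeros (suc x ∷ r) s↓ with nonIncreasing-zeros r (Linked.tail s↓)
... | i , r≡ = i , cong (suc x ∷_) r≡

-- The paper's μ + λ for lists of any lengths; the parts of λ are added on the left, where 1 + x
-- computes to suc x.
infixl 6 _⊞_

_⊞_ : List ℕ → List ℕ → List ℕ
xs ⊞ [] = xs
[] ⊞ (l ∷ ls) = l ∷ ls
(x ∷ xs) ⊞ (l ∷ ls) = (l + x) ∷ (xs ⊞ ls)

[]-⊞ : ∀ ls → [] ⊞ ls ≡ ls
[]-⊞ [] = refl
[]-⊞ (l ∷ ls) = refl

subPart-⊞ : ∀ ν ls w → subPart ν ls ≡ just w → stripZeros ν ≡ stripZeros (w ⊞ ls)
subPart-⊞ ν [] w refl = refl
subPart-⊞ [] (zero ∷ ls) w eq with subPart [] ls in eq′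
subPart-⊞ [] (zero ∷ ls) w refl | just w′ = subPart-⊞ [] ls w′ eq′
subPart-⊞ (m ∷ ν) (l ∷ ls) w eq with l ≤ᵇ m in l≤ᵇm | subPart ν ls in eq′
subPart-⊞ (m ∷ ν) (l ∷ ls) w refl | true | just w′ =
  trans (cong (λ k → stripZeros (k ∷ ν)) (sym (m+[n∸m]≡n (≤ᵇ⇒≤ l m (subst T (sym l≤ᵇm) tt)))))
    (stripZeros-∷ (l + (m ∸ l)) (subPart-⊞ ν ls w′ eq′))

stripZeros-⊞-zeros : ∀ xs ls i → stripZeros ((xs ++ replicate i 0) ⊞ ls) ≡ stripZeros (xs ⊞ ls)
stripZeros-⊞-zeros [] [] i = stripZeros-zeros i
stripZeros-⊞-zeros [] (l ∷ ls) zero = refl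
stripZeros-⊞-zeros [] (l ∷ ls) (suc i) rewrite +-identityʳ l =
  stripZeros-∷ l (trans (stripZeros-⊞-zeros [] ls i) (cong stripZeros ([]-⊞ ls)))
stripZeros-⊞-zeros (x ∷ xs) [] i = stripZeros-++-zeros (x ∷ xs) i
stripZeros-⊞-zeros (x ∷ xs) (l ∷ ls) i = stripZeros-∷ (l + x) (stripZeros-⊞-zeros xs ls i)

stripZeros-⊞ : ∀ ν ls w s → All (0 <_) ν → subPart ν ls ≡ just w → NonIncreasing w →
  stripZeros s ≡ stripZeros w → NonIncreasing s → stripZeros (s ⊞ ls) ≡ ν
stripZeros-⊞ ν ls w s ν>0 ν-ls≡w w↓ s≈w s↓
  with nonIncreasing-zeros s s↓ | nonIncreasing-zeros w w↓
... | i , s≡ | j , w≡ = begin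
  stripZeros (s ⊞ ls)                                   ≡⟨ cong (λ z → stripZeros (z ⊞ ls)) s≡ ⟩
  stripZeros ((stripZeros s ++ replicate i 0) ⊞ ls)     ≡⟨ stripZeros-⊞-zeros (stripZeros s) ls i ⟩
  stripZeros (stripZeros s ⊞ ls)                        ≡⟨ cong (λ z → stripZeros (z ⊞ ls)) s≈w ⟩
  stripZeros (stripZeros w ⊞ ls)                        ≡⟨ stripZeros-⊞-zeros (stripZeros w) ls j ⟨
  stripZeros ((stripZeros w ++ replicate j 0) ⊞ ls)     ≡⟨ cong (λ z → stripZeros (z ⊞ ls)) w≡ ⟨
  stripZeros (w ⊞ ls)                                   ≡⟨ subPart-⊞ ν ls w ν-ls≡w ⟨
  stripZeros ν                                          ≡⟨ stripZeros-positive ν>0 ⟩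
  ν                                                     ∎
  where open ≡-Reasoning

ShiftInvertible : List ℕ → Set
ShiftInvertible ls = ∀ s₁ s₂ s₃ s₄ → let s = s₁ ∷ s₂ ∷ s₃ ∷ s₄ ∷ [] in NonIncreasing s →
  ∃ λ w → subPart (stripZeros (s ⊞ ls)) ls ≡ just w × NonIncreasing w × stripZeros s ≡ stripZeros w

shiftInvertible-1111 : ShiftInvertible (1 ∷ 1 ∷ 1 ∷ 1 ∷ [])
shiftInvertible-1111 s₁ s₂ s₃ s₄ s↓ = s₁ ∷ s₂ ∷ s₃ ∷ s₄ ∷ [] , refl , s↓ , refl

shiftInvertible-211 : ShiftInvertible (2 ∷ 1 ∷ 1 ∷ [])
shiftInvertible-211 s₁ s₂ s₃ zero (h₁ ∷ h₂ ∷ _) =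
  s₁ ∷ s₂ ∷ s₃ ∷ [] , refl , h₁ ∷ h₂ ∷ [-] , stripZeros-++-zeros (s₁ ∷ s₂ ∷ s₃ ∷ []) 1
shiftInvertible-211 s₁ s₂ s₃ (suc s₄) s↓ = s₁ ∷ s₂ ∷ s₃ ∷ suc s₄ ∷ [] , refl , s↓ , refl

shiftInvertible-22 : ShiftInvertible (2 ∷ 2 ∷ [])
shiftInvertible-22 s₁ s₂ zero zero (h₁ ∷ _) =
  s₁ ∷ s₂ ∷ [] , refl , h₁ ∷ [-] , stripZeros-++-zeros (s₁ ∷ s₂ ∷ []) 2
shiftInvertible-22 s₁ s₂ (suc s₃) zero (h₁ ∷ h₂ ∷ _) =
  s₁ ∷ s₂ ∷ suc s₃ ∷ [] , refl , h₁ ∷ h₂ ∷ [-] , stripZeros-++-zeros (s₁ ∷ s₂ ∷ suc s₃ ∷ []) 1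
shiftInvertible-22 s₁ s₂ (suc s₃) (suc s₄) s↓ = s₁ ∷ s₂ ∷ suc s₃ ∷ suc s₄ ∷ [] , refl , s↓ , refl
shiftInvertible-22 s₁ s₂ zero (suc s₄) (_ ∷ _ ∷ () ∷ _)

nonincᵇ-does : ∀ xs → nonincᵇ xs ≡ does (Linked.linked? _≥?_ xs)
nonincᵇ-does [] = refl
nonincᵇ-does (x ∷ []) = refl
nonincᵇ-does (x ∷ y ∷ xs) = cong ((y ≤ᵇ x) ∧_) (nonincᵇ-does (y ∷ xs))

infixl 6 _⊕ℕ_

_⊕ℕ_ : (List ℕ → ℕ) → List ℕ → List ℕ → ℕ
(F ⊕ℕ ls) μ with subPart μ ls
... | nothing = 0
... | just ν = if nonincᵇ ν then F (stripZeros ν) else 0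

⊕-ℕ : (f : SymFun) (F : List ℕ → ℕ) → (∀ ν → IsPartition ν → f ν ≡ ℤ.+ F ν) →
  ∀ ls μ → (f ⊕ ls) μ ≡ ℤ.+ (F ⊕ℕ ls) μ
⊕-ℕ f F f≡F ls μ with subPart μ ls
... | nothing = refl
... | just ν rewrite nonincᵇ-does ν with Linked.linked? _≥?_ ν
...   | yes ν↓ = f≡F (stripZeros ν) (stripZeros-partition ν ν↓)
...   | no _ = refl

∑-⊕ℕ : ∀ (xs : List X) (c : X → ℕ) (F : X → List ℕ → ℕ) ls μ →
  ∑ xs (λ x → c x * (F x ⊕ℕ ls) μ) ≡ ((λ ρ → ∑ xs (λ x → c x * F x ρ)) ⊕ℕ ls) μ
∑-⊕ℕ xs c F ls μ with subPart μ ls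
... | nothing = ∑-zero xs (λ {x} _ → *-zeroʳ (c x))
... | just ν with nonincᵇ ν
...   | true = refl
...   | false = ∑-zero xs (λ {x} _ → *-zeroʳ (c x))

shift-inverse : ∀ ls → ShiftInvertible ls → ∀ s₁ s₂ s₃ s₄ → let s = s₁ ∷ s₂ ∷ s₃ ∷ s₄ ∷ [] in
  NonIncreasing s → ∀ {ν mw} → stripZeros (s ⊞ ls) ≡ ν → subPart ν ls ≡ mw →
  ∃ λ w → mw ≡ just w × NonIncreasing w × stripZeros s ≡ stripZeros w
shift-inverse ls inv s₁ s₂ s₃ s₄ s↓ refl refl with inv s₁ s₂ s₃ s₄ s↓
... | w , ν-ls , w↓ , s≈w = w , ν-ls , w↓ , s≈w

⟦stripZeros-⊞≟⟧ : ∀ ls → ShiftInvertible ls → ∀ s₁ s₂ s₃ s₄ → let s = s₁ ∷ s₂ ∷ s₃ ∷ s₄ ∷ [] in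
  NonIncreasing s → ∀ ν → All (0 <_) ν →
  ⟦ does (stripZeros (s ⊞ ls) ≟ₗ ν) ⟧ ≡ ((λ ρ → ⟦ does (stripZeros s ≟ₗ ρ) ⟧) ⊕ℕ ls) ν
⟦stripZeros-⊞≟⟧ ls inv s₁ s₂ s₃ s₄ s↓ ν ν>0 with subPart ν ls in ν-ls
... | nothing = ⟦does⟧-no (stripZeros (s ⊞ ls) ≟ₗ ν) (λ eq → case shift-inverse ls inv s₁ s₂ s₃ s₄ s↓ eq ν-ls of λ ())
  where
  s : List ℕ
  s = s₁ ∷ s₂ ∷ s₃ ∷ s₄ ∷ []
... | just w rewrite nonincᵇ-does w with Linked.linked? _≥?_ w
...   | yes w↓ = ⟦does⟧-cong (stripZeros (s ⊞ ls) ≟ₗ ν) (stripZeros s ≟ₗ stripZeros w) to from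
  where
  s : List ℕ
  s = s₁ ∷ s₂ ∷ s₃ ∷ s₄ ∷ []
  to : stripZeros (s ⊞ ls) ≡ ν → stripZeros s ≡ stripZeros w
  to eq with shift-inverse ls inv s₁ s₂ s₃ s₄ s↓ eq ν-ls
  ... | _ , refl , _ , s≈w = s≈w
  from : stripZeros s ≡ stripZeros w → stripZeros (s ⊞ ls) ≡ ν
  from s≈w = stripZeros-⊞ ν ls w s ν>0 ν-ls w↓ s≈w s↓
...   | no ¬w↓ = ⟦does⟧-no (stripZeros (s ⊞ ls) ≟ₗ ν) w↓
  where
  s : List ℕ
  s = s₁ ∷ s₂ ∷ s₃ ∷ s₄ ∷ []
  w↓ : ¬ stripZeros (s ⊞ ls) ≡ ν
  w↓ eq with shift-inverse ls inv s₁ s₂ s₃ s₄ s↓ eq ν-ls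
  ... | _ , refl , w↓ , _ = ¬w↓ w↓

toList : PMat → List ℕ
toList (pmat x₁₁ x₁₂ x₁₃ x₁₄ x₂₁ x₂₂ x₂₃ x₃₁ x₃₂ x₄₁) =
  x₁₁ ∷ x₁₂ ∷ x₁₃ ∷ x₁₄ ∷ x₂₁ ∷ x₂₂ ∷ x₂₃ ∷ x₃₁ ∷ x₃₂ ∷ x₄₁ ∷ []

fromList : List ℕ → PMat
fromList (x₁₁ ∷ x₁₂ ∷ x₁₃ ∷ x₁₄ ∷ x₂₁ ∷ x₂₂ ∷ x₂₃ ∷ x₃₁ ∷ x₃₂ ∷ x₄₁ ∷ []) =
  pmat x₁₁ x₁₂ x₁₃ x₁₄ x₂₁ x₂₂ x₂₃ x₃₁ x₃₂ x₄₁
fromList _ = pmat 0 0 0 0 0 0 0 0 0 0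

toList-fromList : ∀ xs → length xs ≡ 10 → toList (fromList xs) ≡ xs
toList-fromList (_ ∷ _ ∷ _ ∷ _ ∷ _ ∷ _ ∷ _ ∷ _ ∷ _ ∷ _ ∷ []) _ = refl

_≟ₘ_ : DecidableEquality PMat
A ≟ₘ B = map′ (cong fromList {toList A} {toList B}) (cong toList) (toList A ≟ₗ toList B)

module _ (α₁ α₂ α₃ : ℕ) where

  bounds : ℕ → List ℕ
  bounds n = map (λ m → n + alpha α₁ α₂ α₃ m) (1 ∷ 2 ∷ 3 ∷ 4 ∷ 2 ∷ 3 ∷ 4 ∷ 3 ∷ 4 ∷ 4 ∷ [])

  -- Opaque, so that comparing sums over it never unfolds the enumeration; boxMats α₁ α₂ α₃ n is
  -- definitionally enumerate (bounds n) fromList.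
  opaque
    matrices : ℕ → List PMat
    matrices = boxMats α₁ α₂ α₃

    matrices≡boxMats : ∀ n → matrices n ≡ boxMats α₁ α₂ α₃ n
    matrices≡boxMats n = refl

  multiplicity-matrices : ∀ n A → Pointwise _≤_ (toList A) (bounds n) → multiplicity _≟ₘ_ A (matrices n) ≡ 1
  multiplicity-matrices n A A≤bounds = begin
    multiplicity _≟ₘ_ A (matrices n)
      ≡⟨ cong (multiplicity _≟ₘ_ A) (matrices≡boxMats n) ⟩
    multiplicity _≟ₘ_ A (enumerate (bounds n) fromList)
      ≡⟨ ∑-enumerate (bounds n) fromList _ ⟩
    ∑ (boxes (bounds n)) (λ xs → ⟦ does (fromList xs ≟ₘ A) ⟧)
      ≡⟨ ∑-cong (boxes (bounds n)) (λ {xs} xs∈ → ⟦does⟧-cong (fromList xs ≟ₘ A) (xs ≟ₗ toList A)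
           (λ { refl → sym (toList-fromList _ (boxes-length (bounds n) xs∈)) }) (λ { refl → refl })) ⟩
    multiplicity _≟ₗ_ (toList A) (boxes (bounds n))
      ≡⟨ multiplicity-boxes A≤bounds ⟩
    1 ∎
    where open ≡-Reasoning

record InP (α₁ α₂ α₃ n : ℕ) (A : PMat) : Set where
  constructor mkInP
  field
    ≤₂₁ : a21 A ≤ a11 A
    ≤₂₂ : a21 A + a22 A ≤ a11 A + a12 A
    ≤₂₃ : a21 A + a22 A + a23 A ≤ a11 A + a12 A + a13 A
    ≤₃₁ : a31 A ≤ a21 A
    ≤₃₂ : a31 A + a32 A ≤ a21 A + a22 A
    ≤₄₁ : a41 A ≤ a31 A
    diagonal₁ : a11 A ≡ n + α₁
    diagonal₂ : a12 A + a21 A ≡ n + α₂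
    diagonal₃ : a13 A + a22 A + a31 A ≡ n + α₃
    diagonal₄ : a14 A + a23 A + a32 A + a41 A ≡ n

-- does (inP? α₁ α₂ α₃ n A) computes to inPᵇ α₁ α₂ α₃ n A, so ⟦ inPᵇ … ⟧ and ⟦ does (inP? …) ⟧ are
-- interchangeable; the same holds for the deciders of the conditions below and condᵇ.
inP? : ∀ α₁ α₂ α₃ n A → Dec (InP α₁ α₂ α₃ n A)
inP? α₁ α₂ α₃ n A =
  map′ (λ (p₁ , p₂ , p₃ , p₄ , p₅ , p₆ , p₇ , p₈ , p₉ , p₁₀) → mkInP p₁ p₂ p₃ p₄ p₅ p₆ p₇ p₈ p₉ p₁₀)
       (λ (mkInP p₁ p₂ p₃ p₄ p₅ p₆ p₇ p₈ p₉ p₁₀) → p₁ , p₂ , p₃ , p₄ , p₅ , p₆ , p₇ , p₈ , p₉ , p₁₀)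
    (a21 A ≤? a11 A ×-dec a21 A + a22 A ≤? a11 A + a12 A ×-dec
     a21 A + a22 A + a23 A ≤? a11 A + a12 A + a13 A ×-dec
     a31 A ≤? a21 A ×-dec a31 A + a32 A ≤? a21 A + a22 A ×-dec a41 A ≤? a31 A ×-dec
     a11 A ≟ n + α₁ ×-dec a12 A + a21 A ≟ n + α₂ ×-dec a13 A + a22 A + a31 A ≟ n + α₃ ×-dec
     a14 A + a23 A + a32 A + a41 A ≟ n)

InP⇒bounded : ∀ {α₁ α₂ α₃ n} A → InP α₁ α₂ α₃ n A → Pointwise _≤_ (toList A) (bounds α₁ α₂ α₃ n)
InP⇒bounded {n = n} (pmat x₁₁ x₁₂ x₁₃ x₁₄ x₂₁ x₂₂ x₂₃ x₃₁ x₃₂ x₄₁) (mkInP _ _ _ _ _ _ d₁ d₂ d₃ d₄) =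
  ≤-reflexive d₁ ∷
  on d₂ (m≤m+n x₁₂ x₂₁) ∷ on d₃ (≤-trans (m≤m+n x₁₃ x₂₂) (m≤m+n _ x₃₁)) ∷
  on d₄′ (≤-trans (m≤m+n x₁₄ x₂₃) (≤-trans (m≤m+n _ x₃₂) (m≤m+n _ x₄₁))) ∷
  on d₂ (m≤n+m x₂₁ x₁₂) ∷ on d₃ (≤-trans (m≤n+m x₂₂ x₁₃) (m≤m+n _ x₃₁)) ∷
  on d₄′ (≤-trans (m≤n+m x₂₃ x₁₄) (≤-trans (m≤m+n _ x₃₂) (m≤m+n _ x₄₁))) ∷
  on d₃ (m≤n+m x₃₁ (x₁₃ + x₂₂)) ∷
  on d₄′ (≤-trans (m≤n+m x₃₂ (x₁₄ + x₂₃)) (m≤m+n _ x₄₁)) ∷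
  on d₄′ (m≤n+m x₄₁ (x₁₄ + x₂₃ + x₃₂)) ∷ []
  where
  on : ∀ {a s t} → s ≡ t → a ≤ s → a ≤ t
  on s≡t a≤s = ≤-trans a≤s (≤-reflexive s≡t)
  d₄′ : x₁₄ + x₂₃ + x₃₂ + x₄₁ ≡ n + 0
  d₄′ = trans d₄ (sym (+-identityʳ n))

shape : PMat → List ℕ
shape (pmat x₁₁ x₁₂ x₁₃ x₁₄ x₂₁ x₂₂ x₂₃ x₃₁ x₃₂ x₄₁) =
  (x₁₁ + x₁₂ + x₁₃ + x₁₄) ∷ (x₂₁ + x₂₂ + x₂₃) ∷ (x₃₁ + x₃₂) ∷ x₄₁ ∷ []

shape-nonIncreasing : ∀ {α₁ α₂ α₃ n} A → InP α₁ α₂ α₃ n A → NonIncreasing (shape A)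
shape-nonIncreasing (pmat _ _ _ x₁₄ _ _ x₂₃ x₃₁ x₃₂ _) (mkInP _ _ ≤₂₃ _ ≤₃₂ ≤₄₁ _ _ _ _) =
  ≤-trans ≤₂₃ (m≤m+n _ x₁₄) ∷ ≤-trans ≤₃₂ (m≤m+n _ x₂₃) ∷ ≤-trans ≤₄₁ (m≤m+n x₃₁ x₃₂) ∷ [-]

infixl 6 _+ₘ_ _∸ₘ_

_+ₘ_ : PMat → PMat → PMat
pmat a₁₁ a₁₂ a₁₃ a₁₄ a₂₁ a₂₂ a₂₃ a₃₁ a₃₂ a₄₁ +ₘ pmat b₁₁ b₁₂ b₁₃ b₁₄ b₂₁ b₂₂ b₂₃ b₃₁ b₃₂ b₄₁ =
  pmat (a₁₁ + b₁₁) (a₁₂ + b₁₂) (a₁₃ + b₁₃) (a₁₄ + b₁₄) (a₂₁ + b₂₁) (a₂₂ + b₂₂) (a₂₃ + b₂₃)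
       (a₃₁ + b₃₁) (a₃₂ + b₃₂) (a₄₁ + b₄₁)

_∸ₘ_ : PMat → PMat → PMat
pmat a₁₁ a₁₂ a₁₃ a₁₄ a₂₁ a₂₂ a₂₃ a₃₁ a₃₂ a₄₁ ∸ₘ pmat b₁₁ b₁₂ b₁₃ b₁₄ b₂₁ b₂₂ b₂₃ b₃₁ b₃₂ b₄₁ =
  pmat (a₁₁ ∸ b₁₁) (a₁₂ ∸ b₁₂) (a₁₃ ∸ b₁₃) (a₁₄ ∸ b₁₄) (a₂₁ ∸ b₂₁) (a₂₂ ∸ b₂₂) (a₂₃ ∸ b₂₃)
       (a₃₁ ∸ b₃₁) (a₃₂ ∸ b₃₂) (a₄₁ ∸ b₄₁)

_≤ₘ_ : PMat → PMat → Set
U ≤ₘ A = Pointwise _≤_ (toList U) (toList A)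

∸ₘ-+ₘ : ∀ U B → (U +ₘ B) ∸ₘ U ≡ B
∸ₘ-+ₘ (pmat u₁₁ u₁₂ u₁₃ u₁₄ u₂₁ u₂₂ u₂₃ u₃₁ u₃₂ u₄₁) (pmat b₁₁ b₁₂ b₁₃ b₁₄ b₂₁ b₂₂ b₂₃ b₃₁ b₃₂ b₄₁)
  rewrite m+n∸m≡n u₁₁ b₁₁ | m+n∸m≡n u₁₂ b₁₂ | m+n∸m≡n u₁₃ b₁₃ | m+n∸m≡n u₁₄ b₁₄ | m+n∸m≡n u₂₁ b₂₁
        | m+n∸m≡n u₂₂ b₂₂ | m+n∸m≡n u₂₃ b₂₃ | m+n∸m≡n u₃₁ b₃₁ | m+n∸m≡n u₃₂ b₃₂ | m+n∸m≡n u₄₁ b₄₁ = refl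

+ₘ-∸ₘ : ∀ U A → U ≤ₘ A → U +ₘ (A ∸ₘ U) ≡ A
+ₘ-∸ₘ (pmat _ _ _ _ _ _ _ _ _ _) (pmat _ _ _ _ _ _ _ _ _ _)
  (e₁ ∷ e₂ ∷ e₃ ∷ e₄ ∷ e₅ ∷ e₆ ∷ e₇ ∷ e₈ ∷ e₉ ∷ e₁₀ ∷ [])
  rewrite m+[n∸m]≡n e₁ | m+[n∸m]≡n e₂ | m+[n∸m]≡n e₃ | m+[n∸m]≡n e₄ | m+[n∸m]≡n e₅
        | m+[n∸m]≡n e₆ | m+[n∸m]≡n e₇ | m+[n∸m]≡n e₈ | m+[n∸m]≡n e₉ | m+[n∸m]≡n e₁₀ = refl

+-interchange₃ : ∀ u₁ b₁ u₂ b₂ u₃ b₃ → (u₁ + b₁) + (u₂ + b₂) + (u₃ + b₃) ≡ (u₁ + u₂ + u₃) + (b₁ + b₂ + b₃)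
+-interchange₃ u₁ b₁ u₂ b₂ u₃ b₃ =
  trans (cong (_+ (u₃ + b₃)) (+-interchange u₁ b₁ u₂ b₂)) (+-interchange (u₁ + u₂) (b₁ + b₂) u₃ b₃)

+-interchange₄ : ∀ u₁ b₁ u₂ b₂ u₃ b₃ u₄ b₄ →
  (u₁ + b₁) + (u₂ + b₂) + (u₃ + b₃) + (u₄ + b₄) ≡ (u₁ + u₂ + u₃ + u₄) + (b₁ + b₂ + b₃ + b₄)
+-interchange₄ u₁ b₁ u₂ b₂ u₃ b₃ u₄ b₄ =
  trans (cong (_+ (u₄ + b₄)) (+-interchange₃ u₁ b₁ u₂ b₂ u₃ b₃)) (+-interchange (u₁ + u₂ + u₃) (b₁ + b₂ + b₃) u₄ b₄)

≤-+-split : ∀ {s t sᵤ tᵤ s₀ t₀} → s ≡ sᵤ + s₀ → t ≡ tᵤ + t₀ → sᵤ ≤ tᵤ → s₀ ≤ t₀ → s ≤ t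
≤-+-split refl refl sᵤ≤tᵤ s₀≤t₀ = +-mono-≤ sᵤ≤tᵤ s₀≤t₀

InP-+ₘ : ∀ {α₁ α₂ α₃ m} U B → InP 0 0 0 1 U → InP α₁ α₂ α₃ m B → InP α₁ α₂ α₃ (suc m) (U +ₘ B)
InP-+ₘ (pmat u₁₁ u₁₂ u₁₃ u₁₄ u₂₁ u₂₂ u₂₃ u₃₁ u₃₂ u₄₁) (pmat b₁₁ b₁₂ b₁₃ b₁₄ b₂₁ b₂₂ b₂₃ b₃₁ b₃₂ b₄₁)
  (mkInP u≤₂₁ u≤₂₂ u≤₂₃ u≤₃₁ u≤₃₂ u≤₄₁ u-d₁ u-d₂ u-d₃ u-d₄) (mkInP b≤₂₁ b≤₂₂ b≤₂₃ b≤₃₁ b≤₃₂ b≤₄₁ b-d₁ b-d₂ b-d₃ b-d₄) =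
  mkInP (+-mono-≤ u≤₂₁ b≤₂₁)
    (≤-+-split (+-interchange u₂₁ b₂₁ u₂₂ b₂₂) (+-interchange u₁₁ b₁₁ u₁₂ b₁₂) u≤₂₂ b≤₂₂)
    (≤-+-split (+-interchange₃ u₂₁ b₂₁ u₂₂ b₂₂ u₂₃ b₂₃) (+-interchange₃ u₁₁ b₁₁ u₁₂ b₁₂ u₁₃ b₁₃) u≤₂₃ b≤₂₃)
    (+-mono-≤ u≤₃₁ b≤₃₁)
    (≤-+-split (+-interchange u₃₁ b₃₁ u₃₂ b₃₂) (+-interchange u₂₁ b₂₁ u₂₂ b₂₂) u≤₃₂ b≤₃₂)
    (+-mono-≤ u≤₄₁ b≤₄₁)
    (cong₂ _+_ u-d₁ b-d₁)
    (trans (+-interchange u₁₂ b₁₂ u₂₁ b₂₁) (cong₂ _+_ u-d₂ b-d₂))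
    (trans (+-interchange₃ u₁₃ b₁₃ u₂₂ b₂₂ u₃₁ b₃₁) (cong₂ _+_ u-d₃ b-d₃))
    (trans (+-interchange₄ u₁₄ b₁₄ u₂₃ b₂₃ u₃₂ b₃₂ u₄₁ b₄₁) (cong₂ _+_ u-d₄ b-d₄))

diagonals-cancel : ∀ {α₁ α₂ α₃ m} U B → InP 0 0 0 1 U → InP α₁ α₂ α₃ (suc m) (U +ₘ B) →
  (a11 B ≡ m + α₁) × (a12 B + a21 B ≡ m + α₂) × (a13 B + a22 B + a31 B ≡ m + α₃) ×
  (a14 B + a23 B + a32 B + a41 B ≡ m)
diagonals-cancel (pmat u₁₁ u₁₂ u₁₃ u₁₄ u₂₁ u₂₂ u₂₃ u₃₁ u₃₂ u₄₁) (pmat b₁₁ b₁₂ b₁₃ b₁₄ b₂₁ b₂₂ b₂₃ b₃₁ b₃₂ b₄₁)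
  (mkInP _ _ _ _ _ _ u-d₁ u-d₂ u-d₃ u-d₄) (mkInP _ _ _ _ _ _ d₁ d₂ d₃ d₄) =
  cancel u-d₁ d₁ ,
  cancel u-d₂ (trans (sym (+-interchange u₁₂ b₁₂ u₂₁ b₂₁)) d₂) ,
  cancel u-d₃ (trans (sym (+-interchange₃ u₁₃ b₁₃ u₂₂ b₂₂ u₃₁ b₃₁)) d₃) ,
  cancel u-d₄ (trans (sym (+-interchange₄ u₁₄ b₁₄ u₂₃ b₂₃ u₃₂ b₃₂ u₄₁ b₄₁)) d₄)
  where
  cancel : ∀ {u b n} → u ≡ 1 + 0 → u + b ≡ suc n → b ≡ n
  cancel refl = suc-injective

InP-cancel : ∀ {α₁ α₂ α₃ m} U B → InP 0 0 0 1 U → InP α₁ α₂ α₃ (suc m) (U +ₘ B) →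
  a21 B ≤ a11 B → a21 B + a22 B ≤ a11 B + a12 B → a21 B + a22 B + a23 B ≤ a11 B + a12 B + a13 B →
  a31 B ≤ a21 B → a31 B + a32 B ≤ a21 B + a22 B → a41 B ≤ a31 B → InP α₁ α₂ α₃ m B
InP-cancel U B U∈P A∈P ≤₂₁ ≤₂₂ ≤₂₃ ≤₃₁ ≤₃₂ ≤₄₁ =
  let d₁ , d₂ , d₃ , d₄ = diagonals-cancel U B U∈P A∈P in mkInP ≤₂₁ ≤₂₂ ≤₂₃ ≤₃₁ ≤₃₂ ≤₄₁ d₁ d₂ d₃ d₄

-- Gelfand–Tsetlin patterns

-- A ∈ P^ℤ_{4,m,α} is the Gelfand–Tsetlin pattern of a semistandard tableau: a_ij is the number of
-- entries i + j - 1 in row i.  chainOf A lists the shapes of the entries ≤ 3, ≤ 2 and ≤ 1.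
Chain : Set
Chain = List ℕ × List ℕ × List ℕ

_≟₃_ : DecidableEquality Chain
_≟₃_ = ×-≡-dec _≟ₗ_ _≟₂_

threeStrips : List ℕ → List Chain
threeStrips ν = dependentPairs (strips ν) twoStrips

threeStrips-sound : ∀ ν {μ₁ μ₂ μ₃} → NonIncreasing ν → (μ₁ , μ₂ , μ₃) ∈ threeStrips ν →
  Interlaces ν μ₁ × Interlaces μ₁ μ₂ × Interlaces μ₂ μ₃
threeStrips-sound ν {μ₁} ν↓ t∈ with ∈-dependentPairs⁻ (strips ν) twoStrips t∈
... | μ₁∈ , p∈ = ν⊒μ₁ , twoStrips-sound μ₁ (Interlaces-nonIncreasing ν μ₁ ν⊒μ₁) p∈
  where
  ν⊒μ₁ : Interlaces ν μ₁
  ν⊒μ₁ = strips-sound ν ν↓ μ₁∈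

multiplicity-threeStrips : ∀ ν μ₁ μ₂ μ₃ → Interlaces ν μ₁ → Interlaces μ₁ μ₂ → Interlaces μ₂ μ₃ →
  multiplicity _≟₃_ (μ₁ , μ₂ , μ₃) (threeStrips ν) ≡ 1
multiplicity-threeStrips ν μ₁ μ₂ μ₃ ν⊒μ₁ μ₁⊒μ₂ μ₂⊒μ₃ =
  trans (multiplicity-dependentPairs _≟ₗ_ _≟₂_ (strips ν) twoStrips μ₁ (μ₂ , μ₃))
    (cong₂ _*_ (multiplicity-strips ν μ₁ ν⊒μ₁) (multiplicity-twoStrips μ₁ μ₂ μ₃ μ₁⊒μ₂ μ₂⊒μ₃))

weight₃ : ℕ → ℕ → ℕ → ℕ → List ℕ → Chain → ℕ
weight₃ a b c d ν (μ , p) = ⟦ size ν ≡ᵇ size μ + a ⟧ * weight₂ b c (pieriCoeff (d ∷ [])) μ p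

pieriCoeff-threeStrips : ∀ a b c d ν → pieriCoeff (a ∷ b ∷ c ∷ d ∷ []) ν ≡ ∑ (threeStrips ν) (weight₃ a b c d ν)
pieriCoeff-threeStrips a b c d ν =
  trans (pieriCoeff-∷ a (b ∷ c ∷ d ∷ []) ν)
    (trans (∑-cong′ (strips ν) (λ μ → cong (⟦ size ν ≡ᵇ size μ + a ⟧ *_) (pieriCoeff-∷∷ b c (d ∷ []) μ)))
      (∑-dependentPairs (strips ν) twoStrips (λ μ → ⟦ size ν ≡ᵇ size μ + a ⟧)
        (weight₂ b c (pieriCoeff (d ∷ [])))))

pieriCoeff-row : ∀ d r → pieriCoeff (d ∷ []) (r ∷ 0 ∷ 0 ∷ 0 ∷ []) ≡ ⟦ r ≡ᵇ d ⟧
pieriCoeff-row d r = begin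
  pieriCoeff (d ∷ []) (r ∷ 0 ∷ 0 ∷ 0 ∷ [])
    ≡⟨ pieriCoeff-∷ d [] (r ∷ 0 ∷ 0 ∷ 0 ∷ []) ⟩
  ∑ (range 0 r ⊗ strips (0 ∷ 0 ∷ 0 ∷ [])) w
    ≡⟨ ∑-⊗ (range 0 r) (strips (0 ∷ 0 ∷ 0 ∷ [])) w ⟩
  ∑ (range 0 r) (λ k → w (k ∷ 0 ∷ 0 ∷ 0 ∷ []) + 0)
    ≡⟨ ∑-cong′ (range 0 r) only-empty ⟩
  ∑ (range 0 r) (λ k → ⟦ does (k ≟ 0) ⟧ * ⟦ r ≡ᵇ d ⟧)
    ≡⟨ ∑-⟦≟⟧-* _≟_ (range 0 r) 0 (λ _ → ⟦ r ≡ᵇ d ⟧) ⟩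
  multiplicity _≟_ 0 (range 0 r) * ⟦ r ≡ᵇ d ⟧
    ≡⟨ cong (_* ⟦ r ≡ᵇ d ⟧) (multiplicity-range {hi = r} z≤n z≤n) ⟩
  1 * ⟦ r ≡ᵇ d ⟧
    ≡⟨ *-identityˡ _ ⟩
  ⟦ r ≡ᵇ d ⟧ ∎
  where
  open ≡-Reasoning
  w : List ℕ → ℕ
  w μ = ⟦ size (r ∷ 0 ∷ 0 ∷ 0 ∷ []) ≡ᵇ size μ + d ⟧ * pieriCoeff [] μ
  only-empty : ∀ k → w (k ∷ 0 ∷ 0 ∷ 0 ∷ []) + 0 ≡ ⟦ does (k ≟ 0) ⟧ * ⟦ r ≡ᵇ d ⟧
  only-empty zero rewrite +-identityʳ r = trans (+-identityʳ _) (trans (*-identityʳ _) (sym (+-identityʳ _)))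
  only-empty (suc k) = trans (+-identityʳ _) (*-zeroʳ ⟦ r + 0 ≡ᵇ suc k + 0 + d ⟧)

weight₃-≢0 : ∀ a b c d ν μ₁ μ₂ μ₃ → weight₃ a b c d ν (μ₁ , μ₂ , μ₃) ≢ 0 →
  size ν ≡ size μ₁ + a × size μ₁ ≡ size μ₂ + b × size μ₂ ≡ size μ₃ + c × pieriCoeff (d ∷ []) μ₃ ≢ 0
weight₃-≢0 a b c d ν μ₁ μ₂ μ₃ ≢0 =
  let e₁ , ≢0₁ = ⟦does⟧*-≢0 (size ν ≟ size μ₁ + a) _ ≢0
      e₂ , ≢0₂ = ⟦does⟧*-≢0 (size μ₁ ≟ size μ₂ + b) _ ≢0₁
      e₃ , ≢0₃ = ⟦does⟧*-≢0 (size μ₂ ≟ size μ₃ + c) _ ≢0₂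
  in e₁ , e₂ , e₃ , ≢0₃

weight₃-≡1 : ∀ a b c d ν μ₁ μ₂ r → size ν ≡ size μ₁ + a → size μ₁ ≡ size μ₂ + b →
  size μ₂ ≡ size (r ∷ 0 ∷ 0 ∷ 0 ∷ []) + c → r ≡ d → weight₃ a b c d ν (μ₁ , μ₂ , r ∷ 0 ∷ 0 ∷ 0 ∷ []) ≡ 1
weight₃-≡1 a b c d ν μ₁ μ₂ r e₁ e₂ e₃ r≡d
  rewrite ⟦does⟧-yes (size ν ≟ size μ₁ + a) e₁
        | weight₂-sizes⁻ b c (pieriCoeff (d ∷ [])) μ₁ μ₂ (r ∷ 0 ∷ 0 ∷ 0 ∷ []) e₂ e₃
        | pieriCoeff-row d r | ⟦does⟧-yes (r ≟ d) r≡d = refl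

chainOf : PMat → Chain
chainOf (pmat x₁₁ x₁₂ x₁₃ _ x₂₁ x₂₂ _ x₃₁ _ _) =
  (x₁₁ + x₁₂ + x₁₃) ∷ (x₂₁ + x₂₂) ∷ x₃₁ ∷ 0 ∷ [] ,
  (x₁₁ + x₁₂) ∷ x₂₁ ∷ 0 ∷ 0 ∷ [] ,
  x₁₁ ∷ 0 ∷ 0 ∷ 0 ∷ []

matrixOf : List ℕ → Chain → PMat
matrixOf (x₁ ∷ x₂ ∷ x₃ ∷ x₄ ∷ []) (p₁ ∷ p₂ ∷ p₃ ∷ _ ∷ [] , q₁ ∷ q₂ ∷ _ ∷ _ ∷ [] , r₁ ∷ _ ∷ _ ∷ _ ∷ []) =
  pmat r₁ (q₁ ∸ r₁) (p₁ ∸ q₁) (x₁ ∸ p₁) q₂ (p₂ ∸ q₂) (x₂ ∸ p₂) p₃ (x₃ ∸ p₃) x₄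
matrixOf _ _ = pmat 0 0 0 0 0 0 0 0 0 0

matrixOf-chainOf : ∀ A → matrixOf (shape A) (chainOf A) ≡ A
matrixOf-chainOf (pmat x₁₁ x₁₂ x₁₃ x₁₄ x₂₁ x₂₂ x₂₃ x₃₁ x₃₂ x₄₁)
  rewrite m+n∸m≡n x₁₁ x₁₂ | m+n∸m≡n (x₁₁ + x₁₂) x₁₃ | m+n∸m≡n (x₁₁ + x₁₂ + x₁₃) x₁₄
        | m+n∸m≡n x₂₁ x₂₂ | m+n∸m≡n (x₂₁ + x₂₂) x₂₃ | m+n∸m≡n x₃₁ x₃₂ = refl

chainOf-interlaces : ∀ {α₁ α₂ α₃ m} A → InP α₁ α₂ α₃ m A →
  let (μ₁ , μ₂ , μ₃) = chainOf A in Interlaces (shape A) μ₁ × Interlaces μ₁ μ₂ × Interlaces μ₂ μ₃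
chainOf-interlaces (pmat x₁₁ x₁₂ x₁₃ x₁₄ x₂₁ x₂₂ x₂₃ x₃₁ x₃₂ x₄₁) (mkInP ≤₂₁ ≤₂₂ ≤₂₃ ≤₃₁ ≤₃₂ ≤₄₁ _ _ _ _) =
  (≤₂₃ , m≤m+n _ x₁₄ , ≤₃₂ , m≤m+n _ x₂₃ , ≤₄₁ , m≤m+n x₃₁ x₃₂ , z≤n) ,
  (≤₂₂ , m≤m+n _ x₁₃ , ≤₃₁ , m≤m+n x₂₁ x₂₂ , z≤n , z≤n , z≤n) ,
  (≤₂₁ , m≤m+n x₁₁ x₁₂ , z≤n , z≤n , z≤n , z≤n , z≤n)

multiplicity-chainOf : ∀ {α₁ α₂ α₃ m} A → InP α₁ α₂ α₃ m A →
  multiplicity _≟₃_ (chainOf A) (threeStrips (shape A)) ≡ 1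
multiplicity-chainOf A@(pmat _ _ _ _ _ _ _ _ _ _) A∈P with chainOf-interlaces A A∈P
... | I₁ , I₂ , I₃ = multiplicity-threeStrips (shape A) _ _ _ I₁ I₂ I₃

weight₃-chainOf : ∀ {α₁ α₂ α₃ m} A → InP α₁ α₂ α₃ m A →
  weight₃ m (m + α₃) (m + α₂) (m + α₁) (shape A) (chainOf A) ≡ 1
weight₃-chainOf {α₁} {α₂} {α₃} A@(pmat x₁₁ x₁₂ x₁₃ x₁₄ x₂₁ x₂₂ x₂₃ x₃₁ x₃₂ x₄₁) (mkInP _ _ _ _ _ _ d₁ d₂ d₃ refl) =
  weight₃-≡1 m (m + α₃) (m + α₂) (m + α₁) (shape A) (proj₁ (chainOf A)) (proj₁ (proj₂ (chainOf A))) x₁₁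
    e₁ e₂ e₃ d₁
  where
  m : ℕ
  m = x₁₄ + x₂₃ + x₃₂ + x₄₁
  e₁ : (x₁₁ + x₁₂ + x₁₃ + x₁₄) + ((x₂₁ + x₂₂ + x₂₃) + ((x₃₁ + x₃₂) + (x₄₁ + 0))) ≡
       ((x₁₁ + x₁₂ + x₁₃) + ((x₂₁ + x₂₂) + (x₃₁ + 0))) + m
  e₁ = solve 10 (λ x₁₁ x₁₂ x₁₃ x₁₄ x₂₁ x₂₂ x₂₃ x₃₁ x₃₂ x₄₁ →
         (x₁₁ :+ x₁₂ :+ x₁₃ :+ x₁₄) :+ ((x₂₁ :+ x₂₂ :+ x₂₃) :+ ((x₃₁ :+ x₃₂) :+ (x₄₁ :+ con 0)))
           := ((x₁₁ :+ x₁₂ :+ x₁₃) :+ ((x₂₁ :+ x₂₂) :+ (x₃₁ :+ con 0))) :+ (x₁₄ :+ x₂₃ :+ x₃₂ :+ x₄₁))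
         refl x₁₁ x₁₂ x₁₃ x₁₄ x₂₁ x₂₂ x₂₃ x₃₁ x₃₂ x₄₁
  e₂ : (x₁₁ + x₁₂ + x₁₃) + ((x₂₁ + x₂₂) + (x₃₁ + 0)) ≡ ((x₁₁ + x₁₂) + (x₂₁ + 0)) + (m + α₃)
  e₂ = trans (solve 6 (λ x₁₁ x₁₂ x₁₃ x₂₁ x₂₂ x₃₁ →
         (x₁₁ :+ x₁₂ :+ x₁₃) :+ ((x₂₁ :+ x₂₂) :+ (x₃₁ :+ con 0))
           := ((x₁₁ :+ x₁₂) :+ (x₂₁ :+ con 0)) :+ (x₁₃ :+ x₂₂ :+ x₃₁)) refl x₁₁ x₁₂ x₁₃ x₂₁ x₂₂ x₃₁)
         (cong ((x₁₁ + x₁₂) + (x₂₁ + 0) +_) d₃)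
  e₃ : (x₁₁ + x₁₂) + (x₂₁ + 0) ≡ (x₁₁ + 0) + (m + α₂)
  e₃ = trans (solve 3 (λ x₁₁ x₁₂ x₂₁ → (x₁₁ :+ x₁₂) :+ (x₂₁ :+ con 0) := (x₁₁ :+ con 0) :+ (x₁₂ :+ x₂₁))
         refl x₁₁ x₁₂ x₂₁) (cong (x₁₁ + 0 +_) d₂)

InP-fromChain : ∀ α₁ α₂ α₃ m r₁ a₁₂ a₁₃ a₁₄ q₂ a₂₂ a₂₃ p₃ a₃₂ x₄ →
  let A = pmat r₁ a₁₂ a₁₃ a₁₄ q₂ a₂₂ a₂₃ p₃ a₃₂ x₄ ; (μ₁ , μ₂ , μ₃) = chainOf A in
  Interlaces (shape A) μ₁ → Interlaces μ₁ μ₂ → Interlaces μ₂ μ₃ →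
  weight₃ m (m + α₃) (m + α₂) (m + α₁) (shape A) (chainOf A) ≢ 0 → InP α₁ α₂ α₃ m A
InP-fromChain α₁ α₂ α₃ m r₁ a₁₂ a₁₃ a₁₄ q₂ a₂₂ a₂₃ p₃ a₃₂ x₄
  (a₁ , _ , a₃ , _ , a₅ , _) (b₁ , _ , b₃ , _) (c₁ , _) ≢0 =
  mkInP c₁ b₁ a₁ b₃ a₃ a₅ (⟦does⟧≢0 (r₁ ≟ m + α₁) (row≢0 ∘ trans (pieriCoeff-row (m + α₁) r₁))) d₂ d₃ d₄
  where
  A : PMat
  A = pmat r₁ a₁₂ a₁₃ a₁₄ q₂ a₂₂ a₂₃ p₃ a₃₂ x₄
  sizes = weight₃-≢0 m (m + α₃) (m + α₂) (m + α₁) (shape A)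
    (proj₁ (chainOf A)) (proj₁ (proj₂ (chainOf A))) (proj₂ (proj₂ (chainOf A))) ≢0
  row≢0 : pieriCoeff (m + α₁ ∷ []) (r₁ ∷ 0 ∷ 0 ∷ 0 ∷ []) ≢ 0
  row≢0 = proj₂ (proj₂ (proj₂ sizes))
  d₂ : a₁₂ + q₂ ≡ m + α₂
  d₂ = +-cancelˡ-≡ r₁ _ _ (begin
    r₁ + (a₁₂ + q₂)        ≡⟨ solve 3 (λ r₁ a₁₂ q₂ → r₁ :+ (a₁₂ :+ q₂) := (r₁ :+ a₁₂) :+ (q₂ :+ con 0)) refl r₁ a₁₂ q₂ ⟩
    (r₁ + a₁₂) + (q₂ + 0)  ≡⟨ proj₁ (proj₂ (proj₂ sizes)) ⟩
    (r₁ + 0) + (m + α₂)    ≡⟨ cong (_+ (m + α₂)) (+-identityʳ r₁) ⟩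
    r₁ + (m + α₂)          ∎)
    where open ≡-Reasoning
  d₃ : a₁₃ + a₂₂ + p₃ ≡ m + α₃
  d₃ = +-cancelˡ-≡ ((r₁ + a₁₂) + (q₂ + 0)) _ _
    (trans (solve 6 (λ r₁ a₁₂ q₂ a₁₃ a₂₂ p₃ → ((r₁ :+ a₁₂) :+ (q₂ :+ con 0)) :+ (a₁₃ :+ a₂₂ :+ p₃)
                       := (r₁ :+ a₁₂ :+ a₁₃) :+ ((q₂ :+ a₂₂) :+ (p₃ :+ con 0))) refl r₁ a₁₂ q₂ a₁₃ a₂₂ p₃)
      (proj₁ (proj₂ sizes)))
  d₄ : a₁₄ + a₂₃ + a₃₂ + x₄ ≡ m
  d₄ = +-cancelˡ-≡ ((r₁ + a₁₂ + a₁₃) + ((q₂ + a₂₂) + (p₃ + 0))) _ _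
    (trans (solve 10 (λ r₁ a₁₂ a₁₃ a₁₄ q₂ a₂₂ a₂₃ p₃ a₃₂ x₄ →
              ((r₁ :+ a₁₂ :+ a₁₃) :+ ((q₂ :+ a₂₂) :+ (p₃ :+ con 0))) :+ (a₁₄ :+ a₂₃ :+ a₃₂ :+ x₄)
                := (r₁ :+ a₁₂ :+ a₁₃ :+ a₁₄) :+ ((q₂ :+ a₂₂ :+ a₂₃) :+ ((p₃ :+ a₃₂) :+ (x₄ :+ con 0))))
              refl r₁ a₁₂ a₁₃ a₁₄ q₂ a₂₂ a₂₃ p₃ a₃₂ x₄)
      (proj₁ sizes))

chain⇒matrix : ∀ α₁ α₂ α₃ m x₁ x₂ x₃ x₄ μ₁ μ₂ μ₃ → let ν = x₁ ∷ x₂ ∷ x₃ ∷ x₄ ∷ [] in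
  Interlaces ν μ₁ → Interlaces μ₁ μ₂ → Interlaces μ₂ μ₃ →
  weight₃ m (m + α₃) (m + α₂) (m + α₁) ν (μ₁ , μ₂ , μ₃) ≢ 0 →
  ∃ λ A → chainOf A ≡ (μ₁ , μ₂ , μ₃) × shape A ≡ ν × InP α₁ α₂ α₃ m A
chain⇒matrix α₁ α₂ α₃ m x₁ x₂ x₃ x₄ μ₁@(_ ∷ _ ∷ _ ∷ _ ∷ []) μ₂@(_ ∷ _ ∷ _ ∷ _ ∷ []) (r₁ ∷ suc r₂ ∷ r₃ ∷ r₄ ∷ []) _ _ _ ≢0 =
  ⊥-elim (proj₂ (proj₂ (proj₂ (weight₃-≢0 m (m + α₃) (m + α₂) (m + α₁) (x₁ ∷ x₂ ∷ x₃ ∷ x₄ ∷ []) μ₁ μ₂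
    (r₁ ∷ suc r₂ ∷ r₃ ∷ r₄ ∷ []) ≢0)))
    (pieriCoeff-vanish (m + α₁ ∷ []) (r₁ ∷ suc r₂ ∷ r₃ ∷ r₄ ∷ []) (s≤s z≤n)))
chain⇒matrix α₁ α₂ α₃ m x₁ x₂ x₃ x₄ (p₁ ∷ p₂ ∷ p₃ ∷ _ ∷ []) (q₁ ∷ q₂ ∷ _ ∷ _ ∷ []) (r₁ ∷ zero ∷ _ ∷ _ ∷ [])
  I₁@(a₁ , a₂ , a₃ , a₄ , a₅ , a₆ , a₇) I₂@(b₁ , b₂ , b₃ , b₄ , z≤n , b₆ , b₇) I₃@(c₁ , c₂ , z≤n , c₄ , z≤n , z≤n , z≤n) ≢0
  with m≤n⇒∃[o]m+o≡n c₂ | m≤n⇒∃[o]m+o≡n b₂ | m≤n⇒∃[o]m+o≡n a₂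
     | m≤n⇒∃[o]m+o≡n b₄ | m≤n⇒∃[o]m+o≡n a₄ | m≤n⇒∃[o]m+o≡n a₆
... | a₁₂ , refl | a₁₃ , refl | a₁₄ , refl | a₂₂ , refl | a₂₃ , refl | a₃₂ , refl =
  pmat r₁ a₁₂ a₁₃ a₁₄ q₂ a₂₂ a₂₃ p₃ a₃₂ x₄ , refl , refl ,
  InP-fromChain α₁ α₂ α₃ m r₁ a₁₂ a₁₃ a₁₄ q₂ a₂₂ a₂₃ p₃ a₃₂ x₄ I₁ I₂ I₃ ≢0

gtWeight : ℕ → ℕ → ℕ → ℕ → List ℕ → PMat → ℕ
gtWeight α₁ α₂ α₃ m ν A = ⟦ inPᵇ α₁ α₂ α₃ m A ⟧ * ⟦ does (shape A ≟ₗ ν) ⟧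

gtWeight-shape : ∀ α₁ α₂ α₃ m A → InP α₁ α₂ α₃ m A → gtWeight α₁ α₂ α₃ m (shape A) A ≡ 1
gtWeight-shape α₁ α₂ α₃ m A A∈P
  rewrite ⟦does⟧-yes (inP? α₁ α₂ α₃ m A) A∈P | ⟦does⟧-yes (shape A ≟ₗ shape A) refl = refl

chain-transported : ∀ α₁ α₂ α₃ m x₁ x₂ x₃ x₄ → let ν = x₁ ∷ x₂ ∷ x₃ ∷ x₄ ∷ [] in NonIncreasing ν →
  ∀ {t} → t ∈ threeStrips ν → weight₃ m (m + α₃) (m + α₂) (m + α₁) ν t ≢ 0 →
  Transported _≟ₘ_ chainOf (matrixOf ν) (matrices α₁ α₂ α₃ m) (gtWeight α₁ α₂ α₃ m ν) t
    (weight₃ m (m + α₃) (m + α₂) (m + α₁) ν t)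
chain-transported α₁ α₂ α₃ m x₁ x₂ x₃ x₄ ν↓ {μ₁ , μ₂ , μ₃} t∈ ≢0
  with threeStrips-sound (x₁ ∷ x₂ ∷ x₃ ∷ x₄ ∷ []) ν↓ t∈
... | I₁ , I₂ , I₃ with chain⇒matrix α₁ α₂ α₃ m x₁ x₂ x₃ x₄ μ₁ μ₂ μ₃ I₁ I₂ I₃ ≢0
... | A , refl , refl , A∈P =
  subst (λ B → multiplicity _≟ₘ_ B (matrices α₁ α₂ α₃ m) ≡ 1) (sym (matrixOf-chainOf A))
    (multiplicity-matrices α₁ α₂ α₃ m A (InP⇒bounded A A∈P)) ,
  cong chainOf (matrixOf-chainOf A) ,
  trans (cong (gtWeight α₁ α₂ α₃ m (shape A)) (matrixOf-chainOf A))
    (trans (gtWeight-shape α₁ α₂ α₃ m A A∈P) (sym (weight₃-chainOf A A∈P)))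

matrix-transported : ∀ α₁ α₂ α₃ m ν {A} → gtWeight α₁ α₂ α₃ m ν A ≢ 0 →
  Transported _≟₃_ (matrixOf ν) chainOf (threeStrips ν) (weight₃ m (m + α₃) (m + α₂) (m + α₁) ν) A
    (gtWeight α₁ α₂ α₃ m ν A)
matrix-transported α₁ α₂ α₃ m ν {A} ≢0
  with ⟦does⟧*-≢0 (inP? α₁ α₂ α₃ m A) _ ≢0
... | A∈P , ≢0′ with ⟦does⟧≢0 (shape A ≟ₗ ν) ≢0′
... | refl =
  multiplicity-chainOf A A∈P , matrixOf-chainOf A ,
  trans (weight₃-chainOf A A∈P) (sym (gtWeight-shape α₁ α₂ α₃ m A A∈P))

pieriCoeff-GT : ∀ α₁ α₂ α₃ m ν → length ν ≡ 4 → NonIncreasing ν →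
  pieriCoeff (m ∷ m + α₃ ∷ m + α₂ ∷ m + α₁ ∷ []) ν ≡ ∑ (matrices α₁ α₂ α₃ m) (gtWeight α₁ α₂ α₃ m ν)
pieriCoeff-GT α₁ α₂ α₃ m ν@(x₁ ∷ x₂ ∷ x₃ ∷ x₄ ∷ []) _ ν↓ =
  trans (pieriCoeff-threeStrips m (m + α₃) (m + α₂) (m + α₁) ν)
    (∑-bijection _≟₃_ _≟ₘ_ (threeStrips ν) (matrices α₁ α₂ α₃ m) _ (gtWeight α₁ α₂ α₃ m ν)
      (matrixOf ν) chainOf (chain-transported α₁ α₂ α₃ m x₁ x₂ x₃ x₄ ν↓)
      (λ _ → matrix-transported α₁ α₂ α₃ m ν))

-- Counting matrices by shape, and the operators Δ^λ

count : ∀ α₁ α₂ α₃ {C : Pred PMat 0ℓ} → Decidable C → ℕ → List ℕ → ℕ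
count α₁ α₂ α₃ C? m ν =
  ∑ (matrices α₁ α₂ α₃ m) (λ A → ⟦ inPᵇ α₁ α₂ α₃ m A ⟧ * ⟦ does (C? A) ⟧ * ⟦ does (stripZeros (shape A) ≟ₗ ν) ⟧)

-- One application of Δ^border: the matrices of P(m+1) satisfying C but not D are exactly unit +ₘ B
-- for B ∈ P(m) satisfying C, and they cancel against the shifted count of P(m).
record Peeling (α₁ α₂ α₃ : ℕ) (C D : Pred PMat 0ℓ) : Set where
  field
    unit : PMat
    unit-valid : InP 0 0 0 1 unit
    border : List ℕ
    shape-grow : ∀ B → shape (unit +ₘ B) ≡ shape B ⊞ border
    border-invertible : ShiftInvertible border
    unit-≤ : ∀ {m A} → InP α₁ α₂ α₃ (suc m) A → C A → ¬ D A → unit ≤ₘ A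
    shrink-valid : ∀ {m B} → InP α₁ α₂ α₃ (suc m) (unit +ₘ B) → C (unit +ₘ B) → ¬ D (unit +ₘ B) →
      InP α₁ α₂ α₃ m B × C B
    grow-valid : ∀ {m B} → InP α₁ α₂ α₃ m B → C B → C (unit +ₘ B) × ¬ D (unit +ₘ B)

⟦does⟧-split : {C D : Pred PMat 0ℓ} (C? : Decidable C) (D? : Decidable D) → ∀ A →
  ⟦ does (C? A) ⟧ ≡ ⟦ does ((C? ∩? D?) A) ⟧ + ⟦ does ((C? ∩? (¬? ∘ D?)) A) ⟧
⟦does⟧-split C? D? A with C? A | D? A
... | yes _ | yes _ = refl
... | yes _ | no _ = refl
... | no _ | _ = refl

+[m+n]-+n≡+m : ∀ m n → ℤ.+ (m + n) ℤ.- ℤ.+ n ≡ ℤ.+ m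
+[m+n]-+n≡+m m n = trans (m-n≡m⊖n (m + n) n) (trans (⊖-≥ (m≤n+m n m)) (cong ℤ.+_ (m+n∸n≡m m n)))

module _ {α₁ α₂ α₃ : ℕ} {C D : Pred PMat 0ℓ} (C? : Decidable C) (D? : Decidable D)
         (peeling : Peeling α₁ α₂ α₃ C D) where

  open Peeling peeling

  private
    grow shrink : PMat → PMat
    grow B = unit +ₘ B
    shrink A = A ∸ₘ unit
    grow-shrink : ∀ {m A} → InP α₁ α₂ α₃ (suc m) A → C A → ¬ D A → grow (shrink A) ≡ A
    grow-shrink A∈P c ¬d = +ₘ-∸ₘ unit _ (unit-≤ A∈P c ¬d)
    P : ℕ → Pred PMat 0ℓ
    P = InP α₁ α₂ α₃
    P? : ∀ m → Decidable (P m)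
    P? = inP? α₁ α₂ α₃
    C∖D? : Decidable (C ∩ (¬_ ∘ D))
    C∖D? = C? ∩? (¬? ∘ D?)
    σ≟ : List ℕ → PMat → ℕ
    σ≟ ν A = ⟦ does (stripZeros (shape A) ≟ₗ ν) ⟧
    N : {E : Pred PMat 0ℓ} → Decidable E → ℕ → List ℕ → ℕ
    N = count α₁ α₂ α₃

  shrink-valid′ : ∀ {m A} → P (suc m) A → C A → ¬ D A → P m (shrink A) × C (shrink A)
  shrink-valid′ {m} {A} A∈P c ¬d =
    shrink-valid (subst (P (suc m)) (sym A≡) A∈P) (subst C (sym A≡) c) (¬d ∘ subst D A≡)
    where
    A≡ : grow (shrink A) ≡ A
    A≡ = grow-shrink A∈P c ¬d

  ∑-peeled : ∀ m ν →
    ∑ (matrices α₁ α₂ α₃ (suc m)) (λ A → ⟦ does (P? (suc m) A) ⟧ * ⟦ does (C∖D? A) ⟧ * σ≟ ν A) ≡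
    ∑ (matrices α₁ α₂ α₃ m) (λ B → ⟦ does (P? m B) ⟧ * ⟦ does (C? B) ⟧ * σ≟ ν (grow B))
  ∑-peeled m ν = ∑-bijection _≟ₘ_ _≟ₘ_ (matrices α₁ α₂ α₃ (suc m)) (matrices α₁ α₂ α₃ m) w₁ w₂ shrink grow forth back
    where
    w₁ w₂ : PMat → ℕ
    w₁ A = ⟦ does (P? (suc m) A) ⟧ * ⟦ does (C∖D? A) ⟧ * σ≟ ν A
    w₂ B = ⟦ does (P? m B) ⟧ * ⟦ does (C? B) ⟧ * σ≟ ν (grow B)
    forth : ∀ {A} → A ∈ matrices α₁ α₂ α₃ (suc m) → w₁ A ≢ 0 →
      Transported _≟ₘ_ grow shrink (matrices α₁ α₂ α₃ m) w₂ A (w₁ A)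
    forth {A} _ ≢0 =
      multiplicity-matrices α₁ α₂ α₃ m (shrink A) (InP⇒bounded (shrink A) (proj₁ B-valid)) , A≡ ,
      (begin
        w₂ (shrink A)           ≡⟨ ⟦does⟧²-yes (P? m (shrink A)) (C? (shrink A)) _ (proj₁ B-valid) (proj₂ B-valid) ⟩
        σ≟ ν (grow (shrink A))  ≡⟨ cong (σ≟ ν) A≡ ⟩
        σ≟ ν A                  ≡⟨ ⟦does⟧²-yes (P? (suc m) A) (C∖D? A) _ A∈P (c , ¬d) ⟨
        w₁ A                    ∎)
      where
      open ≡-Reasoning
      A∈P,c¬d : P (suc m) A × C A × ¬ D A
      A∈P,c¬d = ⟦does⟧²-≢0 (P? (suc m) A) (C∖D? A) (σ≟ ν A) ≢0
      A∈P : P (suc m) A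
      A∈P = proj₁ A∈P,c¬d
      c : C A
      c = proj₁ (proj₂ A∈P,c¬d)
      ¬d : ¬ D A
      ¬d = proj₂ (proj₂ A∈P,c¬d)
      A≡ : grow (shrink A) ≡ A
      A≡ = grow-shrink A∈P c ¬d
      B-valid : P m (shrink A) × C (shrink A)
      B-valid = shrink-valid′ A∈P c ¬d
    back : ∀ {B} → B ∈ matrices α₁ α₂ α₃ m → w₂ B ≢ 0 →
      Transported _≟ₘ_ shrink grow (matrices α₁ α₂ α₃ (suc m)) w₁ B (w₂ B)
    back {B} _ ≢0 =
      multiplicity-matrices α₁ α₂ α₃ (suc m) (grow B) (InP⇒bounded (grow B) A∈P) , ∸ₘ-+ₘ unit B ,
      trans (⟦does⟧²-yes (P? (suc m) (grow B)) (C∖D? (grow B)) _ A∈P (grow-valid B∈P c))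
        (sym (⟦does⟧²-yes (P? m B) (C? B) _ B∈P c))
      where
      B∈P : P m B
      B∈P = proj₁ (⟦does⟧²-≢0 (P? m B) (C? B) (σ≟ ν (grow B)) ≢0)
      c : C B
      c = proj₂ (⟦does⟧²-≢0 (P? m B) (C? B) (σ≟ ν (grow B)) ≢0)
      A∈P : P (suc m) (grow B)
      A∈P = InP-+ₘ unit B unit-valid B∈P

  ∑-shifted : ∀ m ν → All (0 <_) ν →
    ∑ (matrices α₁ α₂ α₃ m) (λ B → ⟦ does (P? m B) ⟧ * ⟦ does (C? B) ⟧ * σ≟ ν (grow B)) ≡
    (N C? m ⊕ℕ border) ν
  ∑-shifted m ν ν>0 =
    trans (∑-cong′ (matrices α₁ α₂ α₃ m) shifted)
      (∑-⊕ℕ (matrices α₁ α₂ α₃ m) (λ B → ⟦ does (P? m B) ⟧ * ⟦ does (C? B) ⟧) (λ B ρ → σ≟ ρ B) border ν)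
    where
    shifted : ∀ B → ⟦ does (P? m B) ⟧ * ⟦ does (C? B) ⟧ * σ≟ ν (grow B) ≡
                    ⟦ does (P? m B) ⟧ * ⟦ does (C? B) ⟧ * ((λ ρ → σ≟ ρ B) ⊕ℕ border) ν
    shifted B@(pmat _ _ _ _ _ _ _ _ _ _) = ⟦does⟧-*-cong (P? m B) ⟦ does (C? B) ⟧ λ B∈P →
      trans (cong (λ s → ⟦ does (stripZeros s ≟ₗ ν) ⟧) (shape-grow B))
        (⟦stripZeros-⊞≟⟧ border border-invertible _ _ _ _ (shape-nonIncreasing B B∈P) ν ν>0)

  count-step : ∀ m ν → All (0 <_) ν →
    N C? (suc m) ν ≡ N (C? ∩? D?) (suc m) ν + (N C? m ⊕ℕ border) ν
  count-step m ν ν>0 = begin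
    N C? (suc m) ν
      ≡⟨ ∑-cong′ (matrices α₁ α₂ α₃ (suc m)) split ⟩
    ∑ (matrices α₁ α₂ α₃ (suc m)) (λ A → w (C? ∩? D?) A + w C∖D? A)
      ≡⟨ ∑-+ (matrices α₁ α₂ α₃ (suc m)) (w (C? ∩? D?)) (w C∖D?) ⟩
    N (C? ∩? D?) (suc m) ν + ∑ (matrices α₁ α₂ α₃ (suc m)) (w C∖D?)
      ≡⟨ cong (N (C? ∩? D?) (suc m) ν +_) (trans (∑-peeled m ν) (∑-shifted m ν ν>0)) ⟩
    N (C? ∩? D?) (suc m) ν + (N C? m ⊕ℕ border) ν ∎
    where
    open ≡-Reasoning
    w : {E : Pred PMat 0ℓ} → Decidable E → PMat → ℕ
    w E? A = ⟦ does (P? (suc m) A) ⟧ * ⟦ does (E? A) ⟧ * σ≟ ν A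
    split : ∀ A → ⟦ does (P? (suc m) A) ⟧ * ⟦ does (C? A) ⟧ * σ≟ ν A ≡ w (C? ∩? D?) A + w C∖D? A
    split A rewrite ⟦does⟧-split C? D? A =
      solve 4 (λ p c d s → p :* (c :+ d) :* s := p :* c :* s :+ p :* d :* s) refl
        ⟦ does (P? (suc m) A) ⟧ ⟦ does ((C? ∩? D?) A) ⟧ ⟦ does (C∖D? A) ⟧ (σ≟ ν A)

  Δ-count : ∀ (g : Seq) k → (∀ m → k ≤ m → ∀ ν → IsPartition ν → g m ν ≡ ℤ.+ N C? m ν) →
    ∀ m → suc k ≤ m → ∀ ν → IsPartition ν → Δ border g m ν ≡ ℤ.+ N (C? ∩? D?) m ν
  Δ-count g k g≡count (suc m) (s≤s k≤m) ν ν∈Par@(_ , ν>0) = begin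
    g (suc m) ν ℤ.- (g m ⊕ border) ν
      ≡⟨ cong₂ ℤ._-_ (g≡count (suc m) (m≤n⇒m≤1+n k≤m) ν ν∈Par) (⊕-ℕ (g m) (N C? m) (g≡count m k≤m) border ν) ⟩
    ℤ.+ N C? (suc m) ν ℤ.- ℤ.+ shifted
      ≡⟨ cong (λ n → ℤ.+ n ℤ.- ℤ.+ shifted) (count-step m ν ν>0) ⟩
    ℤ.+ (N (C? ∩? D?) (suc m) ν + shifted) ℤ.- ℤ.+ shifted
      ≡⟨ +[m+n]-+n≡+m (N (C? ∩? D?) (suc m) ν) shifted ⟩
    ℤ.+ N (C? ∩? D?) (suc m) ν ∎
    where
    open ≡-Reasoning
    shifted : ℕ
    shifted = (N C? m ⊕ℕ border) ν

-- ¬ Unpeelableₖ A (together with the earlier conditions) says that A − unitₖ is again a valid matrix.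
Unpeelable₁ Unpeelable₂ Unpeelable₃ Unpeelable₄ : Pred PMat 0ℓ
Unpeelable₁ A = a41 A ≡ 0
Unpeelable₂ A = a14 A ≡ 0 ⊎ a31 A ≡ 0
Unpeelable₃ A = a13 A ≡ 0 ⊎ a32 A ≡ 0 ⊎ a31 A ≡ a21 A ⊎ a21 A + a22 A + a23 A ≡ a11 A + a12 A + a13 A
Unpeelable₄ A =
  a12 A ≡ 0 ⊎ a22 A ≡ 0 ⊎ a23 A ≡ 0 ⊎ a21 A + a22 A ≡ a11 A + a12 A ⊎ a31 A + a32 A ≡ a21 A + a22 A

unpeelable₁? : Decidable Unpeelable₁
unpeelable₁? A = a41 A ≟ 0

unpeelable₂? : Decidable Unpeelable₂
unpeelable₂? A = a14 A ≟ 0 ⊎-dec a31 A ≟ 0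

unpeelable₃? : Decidable Unpeelable₃
unpeelable₃? A =
  a13 A ≟ 0 ⊎-dec a32 A ≟ 0 ⊎-dec a31 A ≟ a21 A ⊎-dec a21 A + a22 A + a23 A ≟ a11 A + a12 A + a13 A

unpeelable₄? : Decidable Unpeelable₄
unpeelable₄? A =
  a12 A ≟ 0 ⊎-dec a22 A ≟ 0 ⊎-dec a23 A ≟ 0 ⊎-dec a21 A + a22 A ≟ a11 A + a12 A ⊎-dec
  a31 A + a32 A ≟ a21 A + a22 A

Unpeelable≤₁ Unpeelable≤₂ Unpeelable≤₃ Unpeelable≤₄ : Pred PMat 0ℓ
Unpeelable≤₁ = U ∩ Unpeelable₁
Unpeelable≤₂ = Unpeelable≤₁ ∩ Unpeelable₂
Unpeelable≤₃ = Unpeelable≤₂ ∩ Unpeelable₃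
Unpeelable≤₄ = Unpeelable≤₃ ∩ Unpeelable₄

unpeelable≤₁? : Decidable Unpeelable≤₁
unpeelable≤₁? = U? ∩? unpeelable₁?

unpeelable≤₂? : Decidable Unpeelable≤₂
unpeelable≤₂? = unpeelable≤₁? ∩? unpeelable₂?

unpeelable≤₃? : Decidable Unpeelable≤₃
unpeelable≤₃? = unpeelable≤₂? ∩? unpeelable₃?

unpeelable≤₄? : Decidable Unpeelable≤₄
unpeelable≤₄? = unpeelable≤₃? ∩? unpeelable₄?

unit₁ unit₂ unit₃ unit₄ : PMat
unit₁ = pmat 1 0 0 0 1 0 0 1 0 1
unit₂ = pmat 1 0 0 1 1 0 0 1 0 0
unit₃ = pmat 1 0 1 0 1 0 0 0 1 0
unit₄ = pmat 1 1 0 0 0 1 1 0 0 0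

unit₁-valid : InP 0 0 0 1 unit₁
unit₁-valid = from-yes (inP? 0 0 0 1 unit₁)

unit₂-valid : InP 0 0 0 1 unit₂
unit₂-valid = from-yes (inP? 0 0 0 1 unit₂)

unit₃-valid : InP 0 0 0 1 unit₃
unit₃-valid = from-yes (inP? 0 0 0 1 unit₃)

unit₄-valid : InP 0 0 0 1 unit₄
unit₄-valid = from-yes (inP? 0 0 0 1 unit₄)

≤-pred-≢ : ∀ {m n} → m ≤ suc n → m ≢ suc n → m ≤ n
≤-pred-≢ m≤1+n m≢1+n = ≤-pred (≤∧≢⇒< m≤1+n m≢1+n)

module _ {α₁ α₂ α₃ : ℕ} where

  private
    P : ℕ → Pred PMat 0ℓ
    P = InP α₁ α₂ α₃

  peeling₁ : Peeling α₁ α₂ α₃ U Unpeelable₁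
  peeling₁ = record
    { unit = unit₁
    ; unit-valid = unit₁-valid
    ; border = 1 ∷ 1 ∷ 1 ∷ 1 ∷ []
    ; shape-grow = λ { (pmat _ _ _ _ _ _ _ _ _ _) → refl }
    ; border-invertible = shiftInvertible-1111
    ; unit-≤ = unit-≤
    ; shrink-valid = λ {_} {B} A∈P _ _ → shrink-valid B A∈P , tt
    ; grow-valid = λ _ _ → tt , λ ()
    }
    where
    unit-≤ : ∀ {m A} → P (suc m) A → U A → ¬ Unpeelable₁ A → unit₁ ≤ₘ A
    unit-≤ (mkInP ≤₂₁ _ _ ≤₃₁ _ ≤₄₁ _ _ _ _) _ a₄₁≢0 =
      0<a₁₁ ∷ z≤n ∷ z≤n ∷ z≤n ∷ 0<a₂₁ ∷ z≤n ∷ z≤n ∷ 0<a₃₁ ∷ z≤n ∷ 0<a₄₁ ∷ []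
      where
      0<a₄₁ = n≢0⇒n>0 a₄₁≢0
      0<a₃₁ = <-≤-trans 0<a₄₁ ≤₄₁
      0<a₂₁ = <-≤-trans 0<a₃₁ ≤₃₁
      0<a₁₁ = <-≤-trans 0<a₂₁ ≤₂₁
    shrink-valid : ∀ {m} B → P (suc m) (unit₁ +ₘ B) → P m B
    shrink-valid B@(pmat _ _ _ _ _ _ _ _ _ _) A∈P@(mkInP ≤₂₁ ≤₂₂ ≤₂₃ ≤₃₁ ≤₃₂ ≤₄₁ _ _ _ _) =
      InP-cancel unit₁ B unit₁-valid A∈P (≤-pred ≤₂₁) (≤-pred ≤₂₂) (≤-pred ≤₂₃) (≤-pred ≤₃₁) (≤-pred ≤₃₂) (≤-pred ≤₄₁)

  peeling₂ : Peeling α₁ α₂ α₃ Unpeelable≤₁ Unpeelable₂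
  peeling₂ = record
    { unit = unit₂
    ; unit-valid = unit₂-valid
    ; border = 2 ∷ 1 ∷ 1 ∷ []
    ; shape-grow = λ { (pmat b₁₁ b₁₂ b₁₃ b₁₄ b₂₁ b₂₂ b₂₃ b₃₁ b₃₂ b₄₁) →
        cong (λ r → r ∷ suc (b₂₁ + b₂₂ + b₂₃) ∷ suc (b₃₁ + b₃₂) ∷ b₄₁ ∷ []) (cong suc (+-suc (b₁₁ + b₁₂ + b₁₃) b₁₄)) }
    ; border-invertible = shiftInvertible-211
    ; unit-≤ = unit-≤
    ; shrink-valid = λ {_} {B} A∈P c _ → shrink-valid B A∈P c , c
    ; grow-valid = λ _ c → c , [ (λ ()) , (λ ()) ]
    }
    where
    unit-≤ : ∀ {m A} → P (suc m) A → Unpeelable≤₁ A → ¬ Unpeelable₂ A → unit₂ ≤ₘ A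
    unit-≤ (mkInP ≤₂₁ _ _ ≤₃₁ _ _ _ _ _ _) _ ¬d =
      0<a₁₁ ∷ z≤n ∷ z≤n ∷ 0<a₁₄ ∷ 0<a₂₁ ∷ z≤n ∷ z≤n ∷ 0<a₃₁ ∷ z≤n ∷ z≤n ∷ []
      where
      0<a₁₄ = n≢0⇒n>0 (¬d ∘ inj₁)
      0<a₃₁ = n≢0⇒n>0 (¬d ∘ inj₂)
      0<a₂₁ = <-≤-trans 0<a₃₁ ≤₃₁
      0<a₁₁ = <-≤-trans 0<a₂₁ ≤₂₁
    shrink-valid : ∀ {m} B → P (suc m) (unit₂ +ₘ B) → Unpeelable≤₁ (unit₂ +ₘ B) → P m B
    shrink-valid B@(pmat _ _ _ _ _ _ _ _ _ _) A∈P@(mkInP ≤₂₁ ≤₂₂ ≤₂₃ ≤₃₁ ≤₃₂ _ _ _ _ _) (_ , refl) =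
      InP-cancel unit₂ B unit₂-valid A∈P (≤-pred ≤₂₁) (≤-pred ≤₂₂) (≤-pred ≤₂₃) (≤-pred ≤₃₁) (≤-pred ≤₃₂) z≤n

  peeling₃ : Peeling α₁ α₂ α₃ Unpeelable≤₂ Unpeelable₃
  peeling₃ = record
    { unit = unit₃
    ; unit-valid = unit₃-valid
    ; border = 2 ∷ 1 ∷ 1 ∷ []
    ; shape-grow = λ { (pmat b₁₁ b₁₂ b₁₃ b₁₄ b₂₁ b₂₂ b₂₃ b₃₁ b₃₂ b₄₁) →
        cong₂ (λ r₁ r₃ → r₁ ∷ suc (b₂₁ + b₂₂ + b₂₃) ∷ r₃ ∷ b₄₁ ∷ [])
          (cong suc (cong (_+ b₁₄) (+-suc (b₁₁ + b₁₂) b₁₃))) (+-suc b₃₁ b₃₂) }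
    ; border-invertible = shiftInvertible-211
    ; unit-≤ = unit-≤
    ; shrink-valid = λ {_} {B} A∈P c ¬d → shrink-valid B A∈P ¬d , c
    ; grow-valid = λ B∈P c → c , grown-stuck _ B∈P
    }
    where
    unit-≤ : ∀ {m A} → P (suc m) A → Unpeelable≤₂ A → ¬ Unpeelable₃ A → unit₃ ≤ₘ A
    unit-≤ (mkInP ≤₂₁ _ _ ≤₃₁ _ _ _ _ _ _) _ ¬d =
      0<a₁₁ ∷ z≤n ∷ 0<a₁₃ ∷ z≤n ∷ 0<a₂₁ ∷ z≤n ∷ z≤n ∷ z≤n ∷ 0<a₃₂ ∷ z≤n ∷ []
      where
      0<a₁₃ = n≢0⇒n>0 (¬d ∘ inj₁)
      0<a₃₂ = n≢0⇒n>0 (¬d ∘ inj₂ ∘ inj₁)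
      0<a₂₁ = ≤-<-trans z≤n (≤∧≢⇒< ≤₃₁ (¬d ∘ inj₂ ∘ inj₂ ∘ inj₁))
      0<a₁₁ = <-≤-trans 0<a₂₁ ≤₂₁
    shrink-valid : ∀ {m} B → P (suc m) (unit₃ +ₘ B) → ¬ Unpeelable₃ (unit₃ +ₘ B) → P m B
    shrink-valid B@(pmat b₁₁ b₁₂ b₁₃ _ b₂₁ b₂₂ b₂₃ b₃₁ b₃₂ _) A∈P@(mkInP ≤₂₁ ≤₂₂ ≤₂₃ ≤₃₁ ≤₃₂ ≤₄₁ _ _ _ _) ¬d =
      InP-cancel unit₃ B unit₃-valid A∈P (≤-pred ≤₂₁) (≤-pred ≤₂₂) row₂≤row₁ (≤-pred-≢ ≤₃₁ (¬d ∘ inj₂ ∘ inj₂ ∘ inj₁))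
        (≤-pred (subst (_≤ suc (b₂₁ + b₂₂)) (+-suc b₃₁ b₃₂) ≤₃₂)) ≤₄₁
      where
      row₂≤row₁ : b₂₁ + b₂₂ + b₂₃ ≤ b₁₁ + b₁₂ + b₁₃
      row₂≤row₁ = ≤-pred-≢ (subst (b₂₁ + b₂₂ + b₂₃ ≤_) (+-suc (b₁₁ + b₁₂) b₁₃) (≤-pred ≤₂₃))
        (λ e → ¬d (inj₂ (inj₂ (inj₂ (cong suc (trans e (sym (+-suc (b₁₁ + b₁₂) b₁₃))))))))
    grown-stuck : ∀ {m} B → P m B → ¬ Unpeelable₃ (unit₃ +ₘ B)
    grown-stuck (pmat b₁₁ b₁₂ b₁₃ _ b₂₁ b₂₂ b₂₃ _ _ _) (mkInP _ _ ≤₂₃ ≤₃₁ _ _ _ _ _ _) =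
      [ (λ ()) , [ (λ ()) , [ <⇒≢ (s≤s ≤₃₁) , (λ e → <⇒≢ row₂<row₁ (suc-injective e)) ] ] ]
      where
      row₂<row₁ = subst (b₂₁ + b₂₂ + b₂₃ <_) (sym (+-suc (b₁₁ + b₁₂) b₁₃)) (s≤s ≤₂₃)

  peeling₄ : α₂ ≤ α₁ → Peeling α₁ α₂ α₃ Unpeelable≤₃ Unpeelable₄
  peeling₄ α₂≤α₁ = record
    { unit = unit₄
    ; unit-valid = unit₄-valid
    ; border = 2 ∷ 2 ∷ []
    ; shape-grow = λ { (pmat b₁₁ b₁₂ b₁₃ b₁₄ b₂₁ b₂₂ b₂₃ b₃₁ b₃₂ b₄₁) →
        cong₂ (λ r₁ r₂ → r₁ ∷ r₂ ∷ b₃₁ + b₃₂ ∷ b₄₁ ∷ [])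
          (cong suc (cong (λ z → z + b₁₃ + b₁₄) (+-suc b₁₁ b₁₂))) (+-suc-suc b₂₁ b₂₂ b₂₃) }
    ; border-invertible = shiftInvertible-22
    ; unit-≤ = unit-≤
    ; shrink-valid = λ {_} {B} A∈P c ¬d → shrink-valid B A∈P ¬d , Data.Product.map₂ (Equivalence.to (Unpeelable₃-unit₄ B)) c
    ; grow-valid = λ {_} {B} B∈P c → Data.Product.map₂ (Equivalence.from (Unpeelable₃-unit₄ B)) c , grown-stuck B B∈P
    }
    where
    +-suc-suc : ∀ a b c → a + suc b + suc c ≡ suc (suc (a + b + c))
    +-suc-suc a b c = trans (+-suc (a + suc b) c) (cong suc (cong (_+ c) (+-suc a b)))
    suc-+-suc : ∀ a b c → suc a + suc b + c ≡ suc (suc (a + b + c))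
    suc-+-suc a b c = cong suc (cong (_+ c) (+-suc a b))
    Unpeelable₃-unit₄ : ∀ B → Unpeelable₃ (unit₄ +ₘ B) ⇔ Unpeelable₃ B
    Unpeelable₃-unit₄ (pmat b₁₁ b₁₂ b₁₃ _ b₂₁ b₂₂ b₂₃ _ _ _) = mk⇔
      (Data.Sum.map₂ (Data.Sum.map₂ (Data.Sum.map₂ λ e →
        suc-injective (suc-injective (trans (sym (+-suc-suc b₂₁ b₂₂ b₂₃)) (trans e (suc-+-suc b₁₁ b₁₂ b₁₃)))))))
      (Data.Sum.map₂ (Data.Sum.map₂ (Data.Sum.map₂ λ e →
        trans (+-suc-suc b₂₁ b₂₂ b₂₃) (trans (cong (suc ∘ suc) e) (sym (suc-+-suc b₁₁ b₁₂ b₁₃))))))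
    unit-≤ : ∀ {m A} → P (suc m) A → Unpeelable≤₃ A → ¬ Unpeelable₄ A → unit₄ ≤ₘ A
    unit-≤ (mkInP _ _ _ _ _ _ d₁ _ _ _) _ ¬d =
      0<a₁₁ ∷ 0<a₁₂ ∷ z≤n ∷ z≤n ∷ z≤n ∷ 0<a₂₂ ∷ 0<a₂₃ ∷ z≤n ∷ z≤n ∷ z≤n ∷ []
      where
      0<a₁₁ = subst (0 <_) (sym d₁) (s≤s z≤n)
      0<a₁₂ = n≢0⇒n>0 (¬d ∘ inj₁)
      0<a₂₂ = n≢0⇒n>0 (¬d ∘ inj₂ ∘ inj₁)
      0<a₂₃ = n≢0⇒n>0 (¬d ∘ inj₂ ∘ inj₂ ∘ inj₁)
    shrink-valid : ∀ {m} B → P (suc m) (unit₄ +ₘ B) → ¬ Unpeelable₄ (unit₄ +ₘ B) → P m B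
    shrink-valid {m} B@(pmat b₁₁ b₁₂ b₁₃ _ b₂₁ b₂₂ b₂₃ b₃₁ b₃₂ _) A∈P@(mkInP _ ≤₂₂ ≤₂₃ ≤₃₁ ≤₃₂ ≤₄₁ d₁ d₂ _ _) ¬d =
      InP-cancel unit₄ B unit₄-valid A∈P ≤₂₁′ ≤₂₂′
        (≤-pred (≤-pred (subst₂ _≤_ (+-suc-suc b₂₁ b₂₂ b₂₃) (suc-+-suc b₁₁ b₁₂ b₁₃) ≤₂₃))) ≤₃₁ ≤₃₂′ ≤₄₁
      where
      ≤₂₁′ : b₂₁ ≤ b₁₁
      ≤₂₁′ = begin
        b₂₁            ≤⟨ m≤n+m b₂₁ b₁₂ ⟩
        b₁₂ + b₂₁      ≡⟨ suc-injective d₂ ⟩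
        m + α₂         ≤⟨ +-monoʳ-≤ m α₂≤α₁ ⟩
        m + α₁         ≡⟨ suc-injective d₁ ⟨
        b₁₁            ∎
        where open ≤-Reasoning
      ≤₂₂′ : b₂₁ + b₂₂ ≤ b₁₁ + b₁₂
      ≤₂₂′ = ≤-pred-≢ (≤-pred (subst₂ _≤_ (+-suc b₂₁ b₂₂) (cong suc (+-suc b₁₁ b₁₂)) ≤₂₂))
        (λ e → ¬d (inj₂ (inj₂ (inj₂ (inj₁ (trans (+-suc b₂₁ b₂₂) (trans (cong suc e) (sym (cong suc (+-suc b₁₁ b₁₂))))))))))
      ≤₃₂′ : b₃₁ + b₃₂ ≤ b₂₁ + b₂₂
      ≤₃₂′ = ≤-pred-≢ (subst (b₃₁ + b₃₂ ≤_) (+-suc b₂₁ b₂₂) ≤₃₂)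
        (λ e → ¬d (inj₂ (inj₂ (inj₂ (inj₂ (trans e (sym (+-suc b₂₁ b₂₂))))))))
    grown-stuck : ∀ {m} B → P m B → ¬ Unpeelable₄ (unit₄ +ₘ B)
    grown-stuck (pmat b₁₁ b₁₂ _ _ b₂₁ b₂₂ _ _ _ _) (mkInP _ ≤₂₂ _ _ ≤₃₂ _ _ _ _ _) =
      [ (λ ()) , [ (λ ()) , [ (λ ()) , [ (λ e → <⇒≢ (s≤s (s≤s ≤₂₂)) (trans (sym (+-suc b₂₁ b₂₂)) (trans e (cong suc (+-suc b₁₁ b₁₂)))))
                                      , (λ e → <⇒≢ (s≤s ≤₃₂) (trans e (+-suc b₂₁ b₂₂))) ] ] ] ]

-- The base case: f_m counts all matrices by shape

pad₄ : List ℕ → List ℕ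
pad₄ ν = ν ++ replicate (4 ∸ length ν) 0

zeros-nonIncreasing : ∀ k → NonIncreasing (replicate k 0)
zeros-nonIncreasing zero = []
zeros-nonIncreasing (suc zero) = [-]
zeros-nonIncreasing (suc (suc k)) = z≤n ∷ zeros-nonIncreasing (suc k)

++-zeros-nonIncreasing : ∀ xs k → NonIncreasing xs → NonIncreasing (xs ++ replicate k 0)
++-zeros-nonIncreasing [] k _ = zeros-nonIncreasing k
++-zeros-nonIncreasing (x ∷ []) zero _ = [-]
++-zeros-nonIncreasing (x ∷ []) (suc k) _ = z≤n ∷ zeros-nonIncreasing (suc k)
++-zeros-nonIncreasing (x ∷ y ∷ xs) k (y≤x ∷ xs↓) = y≤x ∷ ++-zeros-nonIncreasing (y ∷ xs) k xs↓

length-pad₄ : ∀ ν → length ν ≤ 4 → length (pad₄ ν) ≡ 4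
length-pad₄ ν ≤4 = trans (length-++ ν) (trans (cong (length ν +_) (length-replicate (4 ∸ length ν))) (m+[n∸m]≡n ≤4))

stripZeros≡⇒pad₄ : ∀ s ν → NonIncreasing s → length s ≡ 4 → stripZeros s ≡ ν → s ≡ pad₄ ν
stripZeros≡⇒pad₄ s ν s↓ len refl with nonIncreasing-zeros s s↓
... | i , s≡ = trans s≡ (cong (λ k → stripZeros s ++ replicate k 0) i≡)
  where
  i≡ : i ≡ 4 ∸ length (stripZeros s)
  i≡ = sym (trans (cong (_∸ length (stripZeros s)) (trans (sym len) (trans (cong length s≡)
          (trans (length-++ (stripZeros s)) (cong (length (stripZeros s) +_) (length-replicate i))))))
          (m+n∸m≡n (length (stripZeros s)) i))

shape≟pad₄ : ∀ {α₁ α₂ α₃ m} A ν → InP α₁ α₂ α₃ m A → All (0 <_) ν →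
  ⟦ does (shape A ≟ₗ pad₄ ν) ⟧ ≡ ⟦ does (stripZeros (shape A) ≟ₗ ν) ⟧
shape≟pad₄ A@(pmat _ _ _ _ _ _ _ _ _ _) ν A∈P ν>0 =
  ⟦does⟧-cong (shape A ≟ₗ pad₄ ν) (stripZeros (shape A) ≟ₗ ν)
    (λ e → trans (cong stripZeros e) (trans (stripZeros-++-zeros ν (4 ∸ length ν)) (stripZeros-positive ν>0)))
    (stripZeros≡⇒pad₄ (shape A) ν (shape-nonIncreasing A A∈P) refl)

All-PositiveAt : ∀ {k ν} → All (0 <_) ν → k < length ν → PositiveAt k ν
All-PositiveAt {zero} (0<x ∷ _) _ = 0<x
All-PositiveAt {suc k} (_ ∷ ν>0) (s≤s k<len) = All-PositiveAt ν>0 k<len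

module _ (α₁ α₂ α₃ : ℕ) where

  private
    P? : ∀ m → Decidable (InP α₁ α₂ α₃ m)
    P? = inP? α₁ α₂ α₃
    σ≟ : List ℕ → PMat → ℕ
    σ≟ ν A = ⟦ does (stripZeros (shape A) ≟ₗ ν) ⟧

  -- pieriCoeff removes the strip of the first factor first, so the content is reversed before the
  -- Gelfand–Tsetlin bijection applies.
  pieriCoeff-count-short : ∀ m ν → length ν ≤ 4 → IsPartition ν →
    pieriCoeff (m + α₁ ∷ m + α₂ ∷ m + α₃ ∷ m ∷ []) ν ≡ count α₁ α₂ α₃ U? m ν
  pieriCoeff-count-short m ν ≤4 (ν↓ , ν>0) = begin
    pieriCoeff (m + α₁ ∷ m + α₂ ∷ m + α₃ ∷ m ∷ []) ν
      ≡⟨ pieriCoeff-padding (m + α₁ ∷ m + α₂ ∷ m + α₃ ∷ m ∷ []) ν (4 ∸ length ν) ⟨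
    pieriCoeff (m + α₁ ∷ m + α₂ ∷ m + α₃ ∷ m ∷ []) (pad₄ ν)
      ≡⟨ pieriCoeff-reverse _ _ _ _ (pad₄ ν) (length-pad₄ ν ≤4) (++-zeros-nonIncreasing ν _ ν↓) ⟩
    pieriCoeff (m ∷ m + α₃ ∷ m + α₂ ∷ m + α₁ ∷ []) (pad₄ ν)
      ≡⟨ pieriCoeff-GT α₁ α₂ α₃ m (pad₄ ν) (length-pad₄ ν ≤4) (++-zeros-nonIncreasing ν _ ν↓) ⟩
    ∑ (matrices α₁ α₂ α₃ m) (gtWeight α₁ α₂ α₃ m (pad₄ ν))
      ≡⟨ ∑-cong′ (matrices α₁ α₂ α₃ m) unpadded ⟩
    count α₁ α₂ α₃ U? m ν ∎
    where
    open ≡-Reasoning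
    unpadded : ∀ A → gtWeight α₁ α₂ α₃ m (pad₄ ν) A ≡ ⟦ does (P? m A) ⟧ * 1 * σ≟ ν A
    unpadded A = trans (cong (_* ⟦ does (shape A ≟ₗ pad₄ ν) ⟧) (sym (*-identityʳ ⟦ does (P? m A) ⟧)))
      (⟦does⟧-*-cong (P? m A) 1 (λ A∈P → shape≟pad₄ A ν A∈P ν>0))

  pieriCoeff-count-long : ∀ m ν → 4 < length ν → IsPartition ν →
    pieriCoeff (m + α₁ ∷ m + α₂ ∷ m + α₃ ∷ m ∷ []) ν ≡ count α₁ α₂ α₃ U? m ν
  pieriCoeff-count-long m ν 4<len (_ , ν>0) =
    trans (pieriCoeff-vanish (m + α₁ ∷ m + α₂ ∷ m + α₃ ∷ m ∷ []) ν (All-PositiveAt ν>0 4<len)) (sym (∑-zero (matrices α₁ α₂ α₃ m) too-long))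
    where
    too-long : ∀ {A} → A ∈ matrices α₁ α₂ α₃ m → ⟦ does (P? m A) ⟧ * 1 * σ≟ ν A ≡ 0
    too-long {A@(pmat _ _ _ _ _ _ _ _ _ _)} _ =
      trans (cong (⟦ does (P? m A) ⟧ * 1 *_) (⟦does⟧-no (stripZeros (shape A) ≟ₗ ν) (λ { refl →
        <⇒≱ 4<len (length-filter nonzero? (shape A)) })))
        (*-zeroʳ (⟦ does (P? m A) ⟧ * 1))

  pieriCoeff-count : ∀ m ν → IsPartition ν →
    pieriCoeff (m + α₁ ∷ m + α₂ ∷ m + α₃ ∷ m ∷ []) ν ≡ count α₁ α₂ α₃ U? m ν
  pieriCoeff-count m ν ν∈Par with length ν ≤? 4
  ... | yes ≤4 = pieriCoeff-count-short m ν ≤4 ν∈Par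
  ... | no ≰4 = pieriCoeff-count-long m ν (≰⇒> ≰4) ν∈Par

listEqᵇ-does : ∀ xs ys → listEqᵇ xs ys ≡ does (xs ≟ₗ ys)
listEqᵇ-does [] [] = refl
listEqᵇ-does [] (_ ∷ _) = refl
listEqᵇ-does (_ ∷ _) [] = refl
listEqᵇ-does (x ∷ xs) (y ∷ ys) = cong ((x ≡ᵇ y) ∧_) (listEqᵇ-does xs ys)

condᵇ-does : ∀ A ν →
  ⟦ condᵇ A ∧ listEqᵇ (rowShape A) ν ⟧ ≡ ⟦ does (unpeelable≤₄? A) ⟧ * ⟦ does (stripZeros (shape A) ≟ₗ ν) ⟧
condᵇ-does (pmat _ _ _ _ _ _ _ _ _ (suc _)) ν = refl
condᵇ-does A@(pmat x₁₁ x₁₂ x₁₃ x₁₄ x₂₁ x₂₂ x₂₃ x₃₁ x₃₂ zero) ν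
  rewrite stripZeros-++-zeros ((x₁₁ + x₁₂ + x₁₃ + x₁₄) ∷ (x₂₁ + x₂₂ + x₂₃) ∷ (x₃₁ + x₃₂) ∷ []) 1
        | listEqᵇ-does (rowShape A) ν =
  reassociate (does (unpeelable₂? A)) (does (unpeelable₃? A)) (does (unpeelable₄? A)) (does (rowShape A ≟ₗ ν))
  where
  reassociate : ∀ a b c d → ⟦ (a ∧ (b ∧ c)) ∧ d ⟧ ≡ ⟦ (a ∧ b) ∧ c ⟧ * ⟦ d ⟧
  reassociate false _ _ _ = refl
  reassociate true false _ _ = refl
  reassociate true true false _ = refl
  reassociate true true true d = sym (+-identityʳ ⟦ d ⟧)

rhs-count : ∀ α₁ α₂ α₃ n ν → rhs α₁ α₂ α₃ n ν ≡ ℤ.+ count α₁ α₂ α₃ unpeelable≤₄? n ν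
rhs-count α₁ α₂ α₃ n ν = cong ℤ.+_ (begin
  length (filterᵇ select (filterᵇ (inPᵇ α₁ α₂ α₃ n) (boxMats α₁ α₂ α₃ n)))
    ≡⟨ length-filterᵇ select (filterᵇ (inPᵇ α₁ α₂ α₃ n) (boxMats α₁ α₂ α₃ n)) ⟩
  ∑ (filterᵇ (inPᵇ α₁ α₂ α₃ n) (boxMats α₁ α₂ α₃ n)) (λ A → ⟦ select A ⟧)
    ≡⟨ ∑-filterᵇ (inPᵇ α₁ α₂ α₃ n) (boxMats α₁ α₂ α₃ n) (λ A → ⟦ select A ⟧) ⟩
  ∑ (boxMats α₁ α₂ α₃ n) (λ A → ⟦ inPᵇ α₁ α₂ α₃ n A ⟧ * ⟦ select A ⟧)
    ≡⟨ cong (λ As → ∑ As (λ A → ⟦ inPᵇ α₁ α₂ α₃ n A ⟧ * ⟦ select A ⟧)) (matrices≡boxMats α₁ α₂ α₃ n) ⟨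
  ∑ (matrices α₁ α₂ α₃ n) (λ A → ⟦ inPᵇ α₁ α₂ α₃ n A ⟧ * ⟦ select A ⟧)
    ≡⟨ ∑-cong′ (matrices α₁ α₂ α₃ n) (λ A →
         trans (cong (⟦ inPᵇ α₁ α₂ α₃ n A ⟧ *_) (condᵇ-does A ν)) (sym (*-assoc ⟦ inPᵇ α₁ α₂ α₃ n A ⟧ _ _))) ⟩
  count α₁ α₂ α₃ unpeelable≤₄? n ν ∎)
  where
  open ≡-Reasoning
  select : PMat → Bool
  select A = condᵇ A ∧ listEqᵇ (rowShape A) ν

lhsSeq-count : ∀ α₁ α₂ α₃ → α₂ ≤ α₁ → ∀ n → 4 ≤ n → ∀ ν → IsPartition ν →
  lhsSeq α₁ α₂ α₃ n ν ≡ ℤ.+ count α₁ α₂ α₃ unpeelable≤₄? n ν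
lhsSeq-count α₁ α₂ α₃ α₂≤α₁ =
  Δ-count unpeelable≤₃? unpeelable₄? (peeling₄ α₂≤α₁) _ 3
    (Δ-count unpeelable≤₂? unpeelable₃? peeling₃ _ 2
      (Δ-count unpeelable≤₁? unpeelable₂? peeling₂ _ 1
        (Δ-count U? unpeelable₁? peeling₁ (fSeq α₁ α₂ α₃) 0
          (λ m _ ν ν∈Par → cong ℤ.+_ (pieriCoeff-count α₁ α₂ α₃ m ν ν∈Par)))))

-- Only peeling₄ needs an inequality between the αᵢ (namely α₂ ≤ α₁).
mainTheorem9 : (α₁ α₂ α₃ : ℕ) → α₁ ≥ α₂ → α₂ ≥ α₃ →
    (n : ℕ) → n ≥ 4 →
    (ν : List ℕ) → IsPartition ν →
    lhsSeq α₁ α₂ α₃ n ν ≡ rhs α₁ α₂ α₃ n ν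
mainTheorem9 α₁ α₂ α₃ α₂≤α₁ _ n 4≤n ν ν∈Par = begin
  lhsSeq α₁ α₂ α₃ n ν                    ≡⟨ lhsSeq-count α₁ α₂ α₃ α₂≤α₁ n 4≤n ν ν∈Par ⟩
  ℤ.+ count α₁ α₂ α₃ unpeelable≤₄? n ν   ≡⟨ rhs-count α₁ α₂ α₃ n ν ⟨
  rhs α₁ α₂ α₃ n ν                       ∎
  where open ≡-Reasoning
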